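{- For every positive integer $n$, the Wasserstein arrangement $\mathcal{W}_n$ consists of exactly \[ |\mathcal{W}_n|=\frac12\sum_{k=2}^{\lfloor n/2\rfloor}\binom{n}{2k}(2k-1)! \] hyperplanes.
   Context: Consider $\mathbb{R}^{\binom n2}$ with coordinates $x_{\{i,j\}}$ indexed by unordered pairs of distinct elements of $[n]$. For $k\ge2$ and $k$-tuples $\mathbf a=(a_1,\dots,a_k)$, $\mathbf b=(b_1,\dots,b_k)$ of elements of $[n]$ such that $a_1,\dots,a_k,b_1,\dots,b_k$ are pairwise distinct, let $H_{\mathbf a,\mathbf b}=\{x\in\mathbb{R}^{\binom n2}:\sum_{i=1}^k x_{\{a_i,b_i\}}=\sum_{i=1}^k x_{\{a_i,b_{i+1}\}}\}$, where $b_{k+1}=b_1$. The Wasserstein arrangement $\mathcal{W}_n$ is the set of all such hyperplanes $H_{\mathbf a,\mathbf b}$ (with $2\le k\le n$).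
   Formalization: The hyperplanes $H_{\mathbf a,\mathbf b}$ are taken in ℚ^(n choose 2) rather than in $\mathbb{R}^{\binom n2}$, and are compared and counted as sets of points with rational coordinates. -}

module Defs where

open import Data.Nat as ℕ using (ℕ; zero; suc; _∸_; _<ᵇ_; NonZero)
open import Data.Nat.DivMod using (_%_; _/_; m%n<n)
open import Data.Nat.Combinatorics using (_C_)
open import Data.Nat.Base using (_!)
open import Data.Fin using (Fin; toℕ; fromℕ<)
open import Data.List using (List; map; upTo; foldr; allFin)
open import Data.Nat.ListAction using (sum)
open import Data.Rational using (ℚ; _+_; 0ℚ)
open import Data.Bool using (if_then_else_)
open import Data.Product using (Σ; _×_; _,_; proj₁)
open import Relation.Binary.PropositionalEquality using (_≡_; _≢_)
import Data.Nat.Properties as ℕP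
open import Function.Definitions using (Injective)

-- A point of ℚ^(n choose 2): coordinates x_{i,j} for i<j are x i j
-- (entries x i j with i ≥ j are ignored).
Point : ℕ → Set
Point n = Fin n → Fin n → ℚ

coord : ∀ {n} → Point n → Fin n → Fin n → ℚ
coord x i j = if toℕ i <ᵇ toℕ j then x i j else x j i

next : ∀ {k} .{{_ : NonZero k}} → Fin k → Fin k
next {k} i = fromℕ< (m%n<n (suc (toℕ i)) k)

sumFin : (k : ℕ) → (Fin k → ℚ) → ℚ
sumFin k f = foldr (λ i s → f i + s) 0ℚ (allFin k)

record WData (n : ℕ) : Set where
  field
    k     : ℕ
    2≤k   : 2 ℕ.≤ k
    k≤n   : k ℕ.≤ n
    a     : Fin k → Fin n
    b     : Fin k → Fin n
    a-inj : Injective _≡_ _≡_ a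
    b-inj : Injective _≡_ _≡_ b
    a≢b   : ∀ i j → a i ≢ b j

H : ∀ {n} → WData n → Point n → Set
H {n} D x = sumFin k (λ i → coord x (a i) (b i))
          ≡ sumFin k (λ i → coord x (a i) (b (next {{nz}} i)))
  where
  open WData D
  nz : NonZero k
  nz = ℕ.>-nonZero (ℕP.≤-trans (ℕ.s≤s ℕ.z≤n) 2≤k)

SameHyp : ∀ {n} → WData n → WData n → Set
SameHyp D E = ∀ x → (H D x → H E x) × (H E x → H D x)

-- the right-hand side, doubled:  Σ_{k=2}^{⌊n/2⌋} C(n,2k) (2k-1)!
twiceCount : ℕ → ℕ
twiceCount n = sum (map (λ k → (n C (2 ℕ.* k)) ℕ.* ((2 ℕ.* k ∸ 1) !))
                        (map (2 ℕ.+_) (upTo (n / 2 ∸ 1))))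

module Submission where

-- H_{a,b} depends only on the cyclic word w = b₁ a₁ b₂ a₂ … b_k a_k: it states that the edges of w
-- in even positions and those in odd positions have the same x-sum, which is invariant under
-- rotating and reflecting w.  Conversely the hyperplane determines the unordered edges of w, since
-- it contains the indicator vector of a pair exactly when that pair is not an edge, and the edges
-- determine w up to rotation and reflection.  So the hyperplanes correspond to canonical words:
-- those starting at their largest vertex M and continuing to the smaller of its two neighbours.
-- For fixed M and length 2k there are C(M,2)·(M−2)(M−3)⋯(M−2k+2) of them, half of
-- C(M,2k−1)·(2k−1)!, and the hockey-stick identity sums these over M < n to ½·C(n,2k)·(2k−1)!.

open import Defs
open import Data.Nat as ℕ using (ℕ; zero; suc; _+_; _*_; _∸_; _≤_; _⊓_; _!; z≤n; s≤s; NonZero)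
import Data.Nat.Properties as ℕ
import Data.Nat.DivMod as ℕ
open import Data.Nat.DivMod using (_/_; m*n/n≡m; /-monoˡ-≤)
open import Data.Nat.Combinatorics using (_C_; nC1≡n; nCk+nC[k+1]≡[n+1]C[k+1])
open import Data.Nat.ListAction using (sum)
import Data.Nat.ListAction.Properties as ℕ
open import Data.Nat.Tactic.RingSolver using (solve-∀)
open import Data.Fin as Fin using (Fin; toℕ; zero; suc; cast; inject₁; fromℕ; fromℕ<)
import Data.Fin.Properties as Fin
open import Data.List
  using (List; []; _∷_; _++_; [_]; _∷ʳ_; length; reverse; zip; map; foldr; tabulate; lookup;
         concatMap; allFin; upTo; applyUpTo)
import Data.List.Properties as List
open import Data.List.Membership.Propositional using (_∈_; _∉_; find; lose)
open import Data.List.Membership.Propositional.Properties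
  using (∈-lookup; ∈-∃++; ∈-++⁺ˡ; ∈-++⁺ʳ; ∈-++⁻; ∈-map⁺; ∈-map⁻; ∈-concatMap⁺; ∈-concatMap⁻;
         ∈-tabulate⁺; ∈-tabulate⁻; ∈-allFin; ∈-upTo⁺)
import Data.List.Membership.DecPropositional as DecMembership
open import Data.List.Relation.Unary.Any as Any using (Any; here; there)
import Data.List.Relation.Unary.Any.Properties as Any
open import Data.List.Relation.Unary.All as All using (All; []; _∷_)
import Data.List.Relation.Unary.All.Properties as All
open import Data.List.Relation.Unary.AllPairs as AllPairs using (AllPairs)
import Data.List.Relation.Unary.AllPairs.Properties as AllPairs
open import Data.List.Relation.Unary.Unique.Propositional using (Unique; []; _∷_)
import Data.List.Relation.Unary.Unique.Propositional.Properties as Unique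
open import Data.List.Relation.Binary.Permutation.Propositional
  using (_↭_; ↭-refl; ↭-sym; ↭-trans; ↭-prep; ↭-swap; ↭⇒↭ₛ)
import Data.List.Relation.Binary.Permutation.Propositional.Properties as ↭
import Data.List.Relation.Binary.Permutation.Setoid.Properties as ↭ₛ
open import Data.Rational as ℚ using (ℚ; 0ℚ; 1ℚ)
import Data.Rational.Properties as ℚ
open import Data.Bool using (true; false; T)
open import Data.Product as Product using (Σ; ∃; _×_; _,_; proj₁; proj₂; swap; uncurry; map₂)
open import Data.Product.Properties using (≡-dec)
open import Data.Sum using (_⊎_; inj₁; inj₂)
open import Data.Empty using (⊥; ⊥-elim)
open import Function using (_∘_; _∘′_; id; _⇔_; mk⇔; Equivalence)
import Function.Properties.Equivalence as ⇔
open import Function.Definitions using (Injective)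
open import Relation.Nullary using (¬_; Dec; yes; no)
open import Relation.Nullary.Decidable using (_⊎-dec_)
open import Relation.Binary.Definitions using (DecidableEquality; tri<; tri≈; tri>)
open import Relation.Binary.PropositionalEquality as ≡
  using (_≡_; _≢_; refl; sym; trans; cong; cong₂; subst; subst₂; module ≡-Reasoning)

private
  variable
    A B : Set
    n : ℕ
    x y z : A
    xs xs′ ys ys′ : List A

-- Cyclic words: rotation, alternate positions and edges

rotate : List A → List A
rotate []       = []
rotate (x ∷ xs) = xs ++ [ x ]

↭-rotate : (xs : List A) → rotate xs ↭ xs
↭-rotate []       = ↭-refl
↭-rotate (x ∷ xs) = ↭-sym (↭.∷↭∷ʳ x xs)

length-rotate : (xs : List A) → length (rotate xs) ≡ length xs
length-rotate xs = ↭.↭-length (↭-rotate xs)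

rotate^ : ℕ → List A → List A
rotate^ zero    xs = xs
rotate^ (suc i) xs = rotate^ i (rotate xs)

rotate^-++ : (xs ys : List A) → rotate^ (length xs) (xs ++ ys) ≡ ys ++ xs
rotate^-++ []       ys = sym (List.++-identityʳ ys)
rotate^-++ (x ∷ xs) ys = begin
  rotate^ (length xs) ((xs ++ ys) ++ [ x ]) ≡⟨ cong (rotate^ (length xs)) (List.++-assoc xs ys [ x ]) ⟩
  rotate^ (length xs) (xs ++ ys ++ [ x ])   ≡⟨ rotate^-++ xs (ys ++ [ x ]) ⟩
  (ys ++ [ x ]) ++ xs                       ≡⟨ List.++-assoc ys [ x ] xs ⟩
  ys ++ x ∷ xs                              ∎
  where open ≡-Reasoning

split-last : (y : A) (ys : List A) → ∃ λ zs → ∃ λ z → y ∷ ys ≡ zs ∷ʳ z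
split-last y []       = [] , y , refl
split-last y (z ∷ zs) with split-last z zs
... | zs′ , z′ , e = y ∷ zs′ , z′ , cong (y ∷_) e

evens odds : List A → List A
evens []       = []
evens (x ∷ xs) = x ∷ odds xs
odds []       = []
odds (x ∷ xs) = evens xs

↭-evens-++-odds : (xs : List A) → evens xs ++ odds xs ↭ xs
↭-evens-++-odds []       = ↭-refl
↭-evens-++-odds (x ∷ xs) =
  ↭-prep x (↭-trans (↭.++-comm (odds xs) (evens xs)) (↭-evens-++-odds xs))

evens-map : (f : A → B) (xs : List A) → evens (map f xs) ≡ map f (evens xs)
odds-map  : (f : A → B) (xs : List A) → odds (map f xs) ≡ map f (odds xs)
evens-map f []       = refl
evens-map f (x ∷ xs) = cong (f x ∷_) (odds-map f xs)
odds-map f []       = refl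
odds-map f (x ∷ xs) = evens-map f xs

evens-zip : (xs : List A) (ys : List B) → length xs ≡ length ys →
            evens (zip xs ys) ≡ zip (evens xs) (evens ys)
odds-zip  : (xs : List A) (ys : List B) → length xs ≡ length ys →
            odds (zip xs ys) ≡ zip (odds xs) (odds ys)
evens-zip []       []       _ = refl
evens-zip (x ∷ xs) (y ∷ ys) e = cong ((x , y) ∷_) (odds-zip xs ys (ℕ.suc-injective e))
odds-zip []       []       _ = refl
odds-zip (x ∷ xs) (y ∷ ys) e = evens-zip xs ys (ℕ.suc-injective e)

data EvenLength {A : Set} : List A → Set where
  []  : EvenLength []
  ∷∷_ : ∀ {x y xs} → EvenLength xs → EvenLength (x ∷ y ∷ xs)

EvenLength-resp-length : EvenLength xs → length xs ≡ length ys → EvenLength ys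
EvenLength-resp-length {ys = []}        []       _ = []
EvenLength-resp-length {ys = _ ∷ _ ∷ _} (∷∷ evn) e =
  ∷∷ EvenLength-resp-length evn (ℕ.suc-injective (ℕ.suc-injective e))

EvenLength-length : ∀ m → length xs ≡ m + m → EvenLength xs
EvenLength-length {xs = []}        _       _ = []
EvenLength-length {xs = _ ∷ []}    zero    ()
EvenLength-length {xs = _ ∷ []}    (suc m) e = ⊥-elim (ℕ.0≢1+n (trans (ℕ.suc-injective e) (ℕ.+-suc m m)))
EvenLength-length {xs = _ ∷ _ ∷ _} zero    ()
EvenLength-length {xs = _ ∷ _ ∷ _} (suc m) e =
  ∷∷ EvenLength-length m (ℕ.suc-injective (trans (ℕ.suc-injective e) (ℕ.+-suc m m)))

length-evens : EvenLength xs → length (evens xs) ≡ length (odds xs)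
length-evens []       = refl
length-evens (∷∷ evn) = cong suc (length-evens evn)

evens-++ : EvenLength xs → evens (xs ++ ys) ≡ evens xs ++ evens ys
evens-++ []            = refl
evens-++ (∷∷_ {x} evn) = cong (x ∷_) (evens-++ evn)

odds-++ : EvenLength xs → odds (xs ++ ys) ≡ odds xs ++ odds ys
odds-++ []                = refl
odds-++ (∷∷_ {y = y} evn) = cong (y ∷_) (odds-++ evn)

evens-rotate : EvenLength xs → evens (rotate xs) ≡ odds xs
evens-rotate []                     = refl
evens-rotate (∷∷_ {x} {y} {xs} evn) =
  cong (y ∷_) (trans (odds-++ evn) (List.++-identityʳ (odds xs)))

odds-rotate : EvenLength xs → odds (rotate xs) ≡ rotate (evens xs)
odds-rotate []       = refl
odds-rotate (∷∷ evn) = evens-++ evn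

reverse-∷∷ : (x y : A) (xs : List A) → reverse (x ∷ y ∷ xs) ≡ reverse xs ++ y ∷ x ∷ []
reverse-∷∷ x y xs = begin
  reverse (x ∷ y ∷ xs)          ≡⟨ List.unfold-reverse x (y ∷ xs) ⟩
  reverse (y ∷ xs) ∷ʳ x         ≡⟨ cong (_∷ʳ x) (List.unfold-reverse y xs) ⟩
  (reverse xs ∷ʳ y) ∷ʳ x        ≡⟨ List.++-assoc (reverse xs) [ y ] [ x ] ⟩
  reverse xs ++ y ∷ x ∷ []      ∎
  where open ≡-Reasoning

EvenLength-reverse : EvenLength xs → EvenLength (reverse xs)
EvenLength-reverse {xs = xs} evn = EvenLength-resp-length evn (sym (List.length-reverse xs))

evens-reverse : EvenLength xs → evens (reverse xs) ≡ reverse (odds xs)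
odds-reverse  : EvenLength xs → odds (reverse xs) ≡ reverse (evens xs)
evens-reverse [] = refl
evens-reverse (∷∷_ {x} {y} {xs} evn) = begin
  evens (reverse (x ∷ y ∷ xs))         ≡⟨ cong evens (reverse-∷∷ x y xs) ⟩
  evens (reverse xs ++ y ∷ x ∷ [])     ≡⟨ evens-++ (EvenLength-reverse evn) ⟩
  evens (reverse xs) ++ [ y ]          ≡⟨ cong (_∷ʳ y) (evens-reverse evn) ⟩
  reverse (odds xs) ∷ʳ y               ≡⟨ List.unfold-reverse y (odds xs) ⟨
  reverse (odds (x ∷ y ∷ xs))          ∎
  where open ≡-Reasoning
odds-reverse [] = refl
odds-reverse (∷∷_ {x} {y} {xs} evn) = begin
  odds (reverse (x ∷ y ∷ xs))          ≡⟨ cong odds (reverse-∷∷ x y xs) ⟩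
  odds (reverse xs ++ y ∷ x ∷ [])      ≡⟨ odds-++ (EvenLength-reverse evn) ⟩
  odds (reverse xs) ++ [ x ]           ≡⟨ cong (_∷ʳ x) (odds-reverse evn) ⟩
  reverse (evens xs) ∷ʳ x              ≡⟨ List.unfold-reverse x (evens xs) ⟨
  reverse (evens (x ∷ y ∷ xs))         ∎
  where open ≡-Reasoning

interleave : List A → List A → List A
interleave []       ys = ys
interleave (x ∷ xs) ys = x ∷ interleave ys xs

interleave-evens-odds : (xs : List A) → interleave (evens xs) (odds xs) ≡ xs
interleave-evens-odds []       = refl
interleave-evens-odds (x ∷ xs) = cong (x ∷_) (interleave-evens-odds xs)

evens-interleave : (xs ys : List A) → length xs ≡ length ys → evens (interleave xs ys) ≡ xs
evens-interleave []       []       _ = refl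
evens-interleave (x ∷ xs) (y ∷ ys) e = cong (x ∷_) (evens-interleave xs ys (ℕ.suc-injective e))

odds-interleave : (xs ys : List A) → length xs ≡ length ys → odds (interleave xs ys) ≡ ys
odds-interleave []       []       _ = refl
odds-interleave (x ∷ xs) (y ∷ ys) e = cong (y ∷_) (odds-interleave xs ys (ℕ.suc-injective e))

length-interleave : (xs ys : List A) → length (interleave xs ys) ≡ length xs + length ys
length-interleave []       ys = refl
length-interleave (x ∷ xs) ys = cong suc (trans (length-interleave ys xs) (ℕ.+-comm (length ys) (length xs)))

↭-interleave : (xs ys : List A) → interleave xs ys ↭ xs ++ ys
↭-interleave []       ys = ↭-refl
↭-interleave (x ∷ xs) ys = ↭-prep x (↭-trans (↭-interleave ys xs) (↭.++-comm ys xs))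

EvenLength-interleave : (xs ys : List A) → length xs ≡ length ys → EvenLength (interleave xs ys)
EvenLength-interleave []       []       _ = []
EvenLength-interleave (x ∷ xs) (y ∷ ys) e = ∷∷ EvenLength-interleave xs ys (ℕ.suc-injective e)

Unique-resp-↭ : xs ↭ ys → Unique xs → Unique ys
Unique-resp-↭ p = ↭ₛ.Unique-resp-↭ (≡.setoid _) (↭⇒↭ₛ p)

lookup-injective : Unique xs → Injective _≡_ _≡_ (lookup xs)
lookup-injective {xs = _ ∷ _} _         {zero}  {zero}  _ = refl
lookup-injective {xs = _ ∷ _} (x∉ ∷ _)  {zero}  {suc j} e = ⊥-elim (All.lookup x∉ (∈-lookup j) e)
lookup-injective {xs = _ ∷ _} (x∉ ∷ _)  {suc i} {zero}  e = ⊥-elim (All.lookup x∉ (∈-lookup i) (sym e))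
lookup-injective {xs = _ ∷ _} (_ ∷ unq) {suc i} {suc j} e = cong suc (lookup-injective unq e)

tabulate-lookup-cast : ∀ {m} (xs : List A) .(e : m ≡ length xs) → tabulate (lookup xs ∘ cast e) ≡ xs
tabulate-lookup-cast {m = zero}  []       _ = refl
tabulate-lookup-cast {m = suc m} (x ∷ xs) e = cong (x ∷_) (tabulate-lookup-cast xs (ℕ.suc-injective e))

Unique-++⁻ˡ : ∀ (xs : List A) → Unique (xs ++ ys) → Unique xs
Unique-++⁻ˡ []       _          = []
Unique-++⁻ˡ (x ∷ xs) (x∉ ∷ unq) = All.++⁻ˡ xs x∉ ∷ Unique-++⁻ˡ xs unq

Unique-++⁻ʳ : ∀ (xs : List A) → Unique (xs ++ ys) → Unique ys
Unique-++⁻ʳ []       unq       = unq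
Unique-++⁻ʳ (x ∷ xs) (_ ∷ unq) = Unique-++⁻ʳ xs unq

Unique-++⁻-disjoint : ∀ (xs : List A) → Unique (xs ++ ys) → x ∈ xs → x ∉ ys
Unique-++⁻-disjoint (x ∷ xs) (x∉ ∷ _)  (here refl)  x∈ys = All.lookup (All.++⁻ʳ xs x∉) x∈ys refl
Unique-++⁻-disjoint (_ ∷ xs) (_ ∷ unq) (there x∈xs) x∈ys = Unique-++⁻-disjoint xs unq x∈xs x∈ys

zip-++ : (xs : List A) (ys : List B) → length xs ≡ length ys →
         zip (xs ++ xs′) (ys ++ ys′) ≡ zip xs ys ++ zip xs′ ys′
zip-++ []       []       _ = refl
zip-++ (x ∷ xs) (y ∷ ys) e = cong ((x , y) ∷_) (zip-++ xs ys (ℕ.suc-injective e))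

zip-rotate : (xs : List A) (ys : List B) → length xs ≡ length ys →
             zip (rotate xs) (rotate ys) ≡ rotate (zip xs ys)
zip-rotate []       []       _ = refl
zip-rotate (x ∷ xs) (y ∷ ys) e = zip-++ xs ys (ℕ.suc-injective e)

zip-reverse : (xs : List A) (ys : List B) → length xs ≡ length ys →
              zip (reverse xs) (reverse ys) ≡ reverse (zip xs ys)
zip-reverse []       []       _ = refl
zip-reverse (x ∷ xs) (y ∷ ys) e = begin
  zip (reverse (x ∷ xs)) (reverse (y ∷ ys))  ≡⟨ cong₂ zip (List.unfold-reverse x xs) (List.unfold-reverse y ys) ⟩
  zip (reverse xs ∷ʳ x) (reverse ys ∷ʳ y)    ≡⟨ zip-++ (reverse xs) (reverse ys) |rev| ⟩
  zip (reverse xs) (reverse ys) ∷ʳ (x , y)   ≡⟨ cong (_∷ʳ (x , y)) (zip-reverse xs ys (ℕ.suc-injective e)) ⟩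
  reverse (zip xs ys) ∷ʳ (x , y)             ≡⟨ List.unfold-reverse (x , y) (zip xs ys) ⟨
  reverse (zip (x ∷ xs) (y ∷ ys))            ∎
  where
  open ≡-Reasoning
  |rev| : length (reverse xs) ≡ length (reverse ys)
  |rev| = trans (List.length-reverse xs) (trans (ℕ.suc-injective e) (sym (List.length-reverse ys)))

∈-zip⁻ˡ : {xs : List A} {ys : List B} → (x , y) ∈ zip xs ys → x ∈ xs
∈-zip⁻ˡ {xs = _ ∷ _} {_ ∷ _} (here refl) = here refl
∈-zip⁻ˡ {xs = _ ∷ _} {_ ∷ _} (there p)   = there (∈-zip⁻ˡ p)

∈-zip⁻ʳ : {xs : List A} {ys : List B} → (x , y) ∈ zip xs ys → y ∈ ys
∈-zip⁻ʳ {xs = _ ∷ _} {_ ∷ _} (here refl) = here refl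
∈-zip⁻ʳ {xs = _ ∷ _} {_ ∷ _} (there p)   = there (∈-zip⁻ʳ p)

∈-zip⁺ : (xs : List A) (ys : List B) → length xs ≡ length ys →
         (x , y) ∈ zip (xs ++ x ∷ xs′) (ys ++ y ∷ ys′)
∈-zip⁺ []       []       _ = here refl
∈-zip⁺ (_ ∷ xs) (_ ∷ ys) e = there (∈-zip⁺ xs ys (ℕ.suc-injective e))

∈-zip-swap : {xs : List A} {ys : List B} → (x , y) ∈ zip xs ys → (y , x) ∈ zip ys xs
∈-zip-swap {xs = _ ∷ _} {_ ∷ _} (here refl) = here refl
∈-zip-swap {xs = _ ∷ _} {_ ∷ _} (there p)   = there (∈-zip-swap p)

∈-zip-pivot : {xs : List A} {ys zs : List B} → Unique xs →
              (x , y) ∈ zip xs ys → (x , z) ∈ zip xs zs → (y , z) ∈ zip ys zs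
∈-zip-pivot {xs = _ ∷ _} {_ ∷ _} {_ ∷ _} _         (here refl) (here refl) = here refl
∈-zip-pivot {xs = _ ∷ _} {_ ∷ _} {_ ∷ _} (x∉ ∷ _)  (here refl) (there p)   = ⊥-elim (All.lookup x∉ (∈-zip⁻ˡ p) refl)
∈-zip-pivot {xs = _ ∷ _} {_ ∷ _} {_ ∷ _} (x∉ ∷ _)  (there p)   (here refl) = ⊥-elim (All.lookup x∉ (∈-zip⁻ˡ p) refl)
∈-zip-pivot {xs = _ ∷ _} {_ ∷ _} {_ ∷ _} (_ ∷ unq) (there p)   (there q)   = there (∈-zip-pivot unq p q)

∈-zip-diagonal : (x , y) ∈ zip xs xs → x ≡ y
∈-zip-diagonal {xs = _ ∷ _} (here refl) = refl
∈-zip-diagonal {xs = _ ∷ _} (there p)   = ∈-zip-diagonal p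

edges : List A → List (A × A)
edges xs = zip xs (rotate xs)

length-edges : (xs : List A) → length (edges xs) ≡ length xs
length-edges xs = trans (List.length-zipWith _,_ xs (rotate xs))
                        (trans (cong (length xs ⊓_) (length-rotate xs)) (ℕ.⊓-idem (length xs)))

edges-rotate : (xs : List A) → edges (rotate xs) ≡ rotate (edges xs)
edges-rotate xs = zip-rotate xs (rotate xs) (sym (length-rotate xs))

edges-reflect : (x : A) (xs : List A) → edges (x ∷ reverse xs) ≡ map swap (reverse (edges (x ∷ xs)))
edges-reflect x xs = sym (begin
  map swap (reverse (zip (x ∷ xs) (xs ++ [ x ])))            ≡⟨ cong (map swap) (zip-reverse (x ∷ xs) (xs ++ [ x ]) |x∷xs|) ⟨
  map swap (zip (reverse (x ∷ xs)) (reverse (xs ++ [ x ])))  ≡⟨ cong₂ (λ as bs → map swap (zip as bs))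
                                                                      (List.unfold-reverse x xs) (List.reverse-++ xs [ x ]) ⟩
  map swap (zip (reverse xs ∷ʳ x) (x ∷ reverse xs))          ≡⟨ List.zip-flip (x ∷ reverse xs) (reverse xs ∷ʳ x) ⟨
  zip (x ∷ reverse xs) (reverse xs ∷ʳ x)                     ∎)
  where
  open ≡-Reasoning
  |x∷xs| : length (x ∷ xs) ≡ length (xs ++ [ x ])
  |x∷xs| = sym (length-rotate (x ∷ xs))

evens-edges : EvenLength xs → evens (edges xs) ≡ zip (evens xs) (odds xs)
evens-edges {xs = xs} evn =
  trans (evens-zip xs (rotate xs) (sym (length-rotate xs))) (cong (zip (evens xs)) (evens-rotate evn))

odds-edges : EvenLength xs → odds (edges xs) ≡ zip (odds xs) (rotate (evens xs))
odds-edges {xs = xs} evn =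
  trans (odds-zip xs (rotate xs) (sym (length-rotate xs))) (cong (zip (odds xs)) (odds-rotate evn))

∈-edges-adjacent : (xs : List A) → (y , z) ∈ edges (xs ++ y ∷ z ∷ ys)
∈-edges-adjacent []                       = here refl
∈-edges-adjacent {y = y} {z} {ys} (x ∷ xs) =
  subst (λ as → (y , z) ∈ zip (x ∷ xs ++ y ∷ z ∷ ys) as) (sym shift)
        (∈-zip⁺ (x ∷ xs) (xs ∷ʳ y) (sym (length-rotate (y ∷ xs))))
  where
  shift : (xs ++ y ∷ z ∷ ys) ∷ʳ x ≡ (xs ∷ʳ y) ++ z ∷ ys ∷ʳ x
  shift = trans (List.++-assoc xs (y ∷ z ∷ ys) [ x ]) (sym (List.++-assoc xs [ y ] (z ∷ ys ∷ʳ x)))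

∈-edges-wrap : (x : A) (xs : List A) (y : A) → (y , x) ∈ edges (x ∷ xs ∷ʳ y)
∈-edges-wrap x xs y = ∈-zip⁺ (x ∷ xs) (xs ∷ʳ y) (sym (length-rotate (y ∷ xs)))

edges-functionalˡ : Unique xs → (x , y) ∈ edges xs → (x , z) ∈ edges xs → y ≡ z
edges-functionalˡ unq p q = ∈-zip-diagonal (∈-zip-pivot unq p q)

edges-functionalʳ : Unique xs → (x , z) ∈ edges xs → (y , z) ∈ edges xs → x ≡ y
edges-functionalʳ {xs = xs} unq p q =
  ∈-zip-diagonal (∈-zip-pivot (Unique-resp-↭ (↭-sym (↭-rotate xs)) unq) (∈-zip-swap p) (∈-zip-swap q))

private
  zip-loopless : Unique (x ∷ xs ∷ʳ z) → (y , y) ∉ zip (x ∷ xs) (xs ∷ʳ z)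
  zip-loopless {xs = []}     ((x≢z ∷ []) ∷ _) (here refl) = x≢z refl
  zip-loopless {xs = _ ∷ _}  ((x≢x′ ∷ _) ∷ _) (here refl) = x≢x′ refl
  zip-loopless {xs = _ ∷ _}  (_ ∷ unq)        (there p)   = zip-loopless unq p

edges-loopless : {xs : List A} {y : A} → Unique xs → 2 ≤ length xs → (y , y) ∉ edges xs
edges-loopless {xs = _ ∷ []}      _                (s≤s ())
edges-loopless {xs = x ∷ x′ ∷ xs} ((x≢x′ ∷ _) ∷ _) _ (here refl) = x≢x′ refl
edges-loopless {xs = x ∷ x′ ∷ xs} unq               _ (there p)   =
  zip-loopless (Unique-resp-↭ (↭-sym (↭-rotate (x ∷ x′ ∷ xs))) unq) p

-- The hyperplane of an alternating cycle

≡⇒⇔ : {P Q : Set} → P ≡ Q → P ⇔ Q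
≡⇒⇔ refl = ⇔.refl

Edge : ℕ → Set
Edge n = Fin n × Fin n

sumQ : List ℚ → ℚ
sumQ = foldr ℚ._+_ 0ℚ

sumQ-↭ : {xs ys : List ℚ} → xs ↭ ys → sumQ xs ≡ sumQ ys
sumQ-↭ p = ↭ₛ.foldr-commMonoid (≡.setoid ℚ) ℚ.+-0-isCommutativeMonoid (↭⇒↭ₛ p)

coord-sym : (x : Point n) (i j : Fin n) → coord x i j ≡ coord x j i
coord-sym x i j with toℕ i ℕ.<ᵇ toℕ j in i<ᵇj | toℕ j ℕ.<ᵇ toℕ i in j<ᵇi
... | true  | true  =
  ⊥-elim (ℕ.<-asym (ℕ.<ᵇ⇒< (toℕ i) (toℕ j) (T-of i<ᵇj)) (ℕ.<ᵇ⇒< (toℕ j) (toℕ i) (T-of j<ᵇi)))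
  where
  T-of : ∀ {b} → b ≡ true → T b
  T-of refl = _
... | true  | false = refl
... | false | true  = refl
... | false | false with ℕ.<-cmp (toℕ i) (toℕ j)
...   | tri< i<j _ _ = ⊥-elim (subst T i<ᵇj (ℕ.<⇒<ᵇ i<j))
...   | tri> _ _ j<i = ⊥-elim (subst T j<ᵇi (ℕ.<⇒<ᵇ j<i))
...   | tri≈ _ i≡j _ with Fin.toℕ-injective i≡j
...     | refl = refl

edgeSum : Point n → List (Edge n) → ℚ
edgeSum x es = sumQ (map (uncurry (coord x)) es)

edgeSum-↭ : (x : Point n) {es es′ : List (Edge n)} → es ↭ es′ → edgeSum x es ≡ edgeSum x es′
edgeSum-↭ x p = sumQ-↭ (↭.map⁺ (uncurry (coord x)) p)

edgeSum-swap : (x : Point n) (es : List (Edge n)) → edgeSum x (map swap es) ≡ edgeSum x es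
edgeSum-swap x []             = refl
edgeSum-swap x ((i , j) ∷ es) = cong₂ ℚ._+_ (coord-sym x j i) (edgeSum-swap x es)

CycleHyp : List (Fin n) → Point n → Set
CycleHyp w x = edgeSum x (evens (edges w)) ≡ edgeSum x (odds (edges w))

private
  flip-sides : {a b c d : ℚ} → a ≡ d → b ≡ c → (a ≡ b) ⇔ (c ≡ d)
  flip-sides a≡d b≡c = mk⇔ (λ a≡b → trans (sym b≡c) (trans (sym a≡b) a≡d))
                          (λ c≡d → trans a≡d (trans (sym c≡d) (sym b≡c)))

CycleHyp-rotate : {w : List (Fin n)} (x : Point n) → EvenLength w → CycleHyp (rotate w) x ⇔ CycleHyp w x
CycleHyp-rotate {w = w} x evn = flip-sides
  (cong (edgeSum x) (trans (cong evens (edges-rotate w)) (evens-rotate evnE)))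
  (trans (cong (edgeSum x) (trans (cong odds (edges-rotate w)) (odds-rotate evnE)))
         (edgeSum-↭ x (↭-rotate (evens (edges w)))))
  where
  evnE : EvenLength (edges w)
  evnE = EvenLength-resp-length evn (sym (length-edges w))

CycleHyp-reflect : (v : Fin n) {t : List (Fin n)} (x : Point n) → EvenLength (v ∷ t) →
                   CycleHyp (v ∷ reverse t) x ⇔ CycleHyp (v ∷ t) x
CycleHyp-reflect v {t} x evn = flip-sides (reflected evens odds (evens-map swap) (evens-reverse evnE))
                                          (reflected odds evens (odds-map swap) (odds-reverse evnE))
  where
  E = edges (v ∷ t)
  evnE : EvenLength E
  evnE = EvenLength-resp-length evn (sym (length-edges (v ∷ t)))
  reflected : (f g : List (Edge _) → List (Edge _)) → (∀ es → f (map swap es) ≡ map swap (f es)) →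
              f (reverse E) ≡ reverse (g E) → edgeSum x (f (edges (v ∷ reverse t))) ≡ edgeSum x (g E)
  reflected f g f-map f-reverse = begin
    edgeSum x (f (edges (v ∷ reverse t)))  ≡⟨ cong (edgeSum x ∘ f) (edges-reflect v t) ⟩
    edgeSum x (f (map swap (reverse E)))   ≡⟨ cong (edgeSum x) (f-map (reverse E)) ⟩
    edgeSum x (map swap (f (reverse E)))   ≡⟨ edgeSum-swap x (f (reverse E)) ⟩
    edgeSum x (f (reverse E))              ≡⟨ cong (edgeSum x) f-reverse ⟩
    edgeSum x (reverse (g E))              ≡⟨ edgeSum-↭ x (↭.↭-reverse (g E)) ⟩
    edgeSum x (g E)                        ∎
    where open ≡-Reasoning

private
  sumFin-tabulate : ∀ {k m} (f : Fin m → ℚ) (g : Fin k → Fin m) →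
                    foldr (λ i s → f i ℚ.+ s) 0ℚ (tabulate g) ≡ sumQ (tabulate (f ∘ g))
  sumFin-tabulate {zero}  f g = refl
  sumFin-tabulate {suc k} f g = cong (f (g Fin.zero) ℚ.+_) (sumFin-tabulate f (g ∘ Fin.suc))

  zip-tabulate : ∀ {k} (f g : Fin k → A) → zip (tabulate f) (tabulate g) ≡ tabulate (λ i → f i , g i)
  zip-tabulate {k = zero}  f g = refl
  zip-tabulate {k = suc k} f g = cong ((f Fin.zero , g Fin.zero) ∷_) (zip-tabulate (f ∘ Fin.suc) (g ∘ Fin.suc))

  tabulate-∷ʳ : ∀ m (f : Fin (suc m) → A) → tabulate f ≡ tabulate (f ∘ inject₁) ∷ʳ f (fromℕ m)
  tabulate-∷ʳ zero    f = refl
  tabulate-∷ʳ (suc m) f = cong (f Fin.zero ∷_) (tabulate-∷ʳ m (f ∘ Fin.suc))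

  next-inject₁ : ∀ m (i : Fin m) → next {suc m} (inject₁ i) ≡ Fin.suc i
  next-inject₁ m i = Fin.toℕ-injective (begin
    toℕ (next {suc m} (inject₁ i))   ≡⟨ Fin.toℕ-fromℕ< _ ⟩
    suc (toℕ (inject₁ i)) ℕ.% suc m  ≡⟨ cong (λ j → suc j ℕ.% suc m) (Fin.toℕ-inject₁ i) ⟩
    suc (toℕ i) ℕ.% suc m            ≡⟨ ℕ.m<n⇒m%n≡m (ℕ.s≤s (Fin.toℕ<n i)) ⟩
    suc (toℕ i)                      ∎)
    where open ≡-Reasoning

  next-fromℕ : ∀ m → next {suc m} (fromℕ m) ≡ Fin.zero
  next-fromℕ m = Fin.toℕ-injective (begin
    toℕ (next {suc m} (fromℕ m))     ≡⟨ Fin.toℕ-fromℕ< _ ⟩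
    suc (toℕ (fromℕ m)) ℕ.% suc m    ≡⟨ cong (λ j → suc j ℕ.% suc m) (Fin.toℕ-fromℕ m) ⟩
    suc m ℕ.% suc m                  ≡⟨ ℕ.n%n≡0 (suc m) ⟩
    0                                ∎)
    where open ≡-Reasoning

tabulate-next : ∀ k .{{_ : NonZero k}} (f : Fin k → A) → tabulate (f ∘ next) ≡ rotate (tabulate f)
tabulate-next (suc m) f = begin
  tabulate (f ∘ next)                                  ≡⟨ tabulate-∷ʳ m (f ∘ next) ⟩
  tabulate (f ∘ next ∘ inject₁) ∷ʳ f (next (fromℕ m))  ≡⟨ cong₂ _∷ʳ_ (List.tabulate-cong (cong f ∘ next-inject₁ m))
                                                                   (cong f (next-fromℕ m)) ⟩
  tabulate (f ∘ Fin.suc) ∷ʳ f Fin.zero                 ∎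
  where open ≡-Reasoning

wordOf : WData n → List (Fin n)
wordOf D = interleave (tabulate b) (tabulate a)
  where open WData D

length-wordOf : (D : WData n) → length (wordOf D) ≡ WData.k D + WData.k D
length-wordOf D = trans (length-interleave (tabulate b) (tabulate a))
                        (cong₂ _+_ (List.length-tabulate b) (List.length-tabulate a))
  where open WData D

Unique-wordOf : (D : WData n) → Unique (wordOf D)
Unique-wordOf D = Unique-resp-↭ (↭-sym (↭-interleave (tabulate b) (tabulate a)))
  (Unique.++⁺ (Unique.tabulate⁺ b-inj) (Unique.tabulate⁺ a-inj) disjoint)
  where
  open WData D
  disjoint : ∀ {v} → v ∈ tabulate b × v ∈ tabulate a → ⊥
  disjoint (v∈b , v∈a) with ∈-tabulate⁻ v∈b | ∈-tabulate⁻ v∈a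
  ... | j , refl | i , bj≡ai = a≢b i j (sym bj≡ai)

H≡CycleHyp-wordOf : (D : WData n) (x : Point n) → H D x ≡ CycleHyp (wordOf D) x
H≡CycleHyp-wordOf D x = cong₂ _≡_ matched shifted
  where
  open WData D
  instance
    _ : NonZero k
    _ = ℕ.>-nonZero (ℕ.≤-trans (ℕ.s≤s ℕ.z≤n) 2≤k)
  Bs = tabulate b
  As = tabulate a
  |B|≡|A| : length Bs ≡ length As
  |B|≡|A| = trans (List.length-tabulate b) (sym (List.length-tabulate a))
  evn : EvenLength (wordOf D)
  evn = EvenLength-interleave Bs As |B|≡|A|
  sumFin≡edgeSum : (g : Fin k → Fin _) → sumFin k (λ i → coord x (a i) (g i)) ≡ edgeSum x (zip As (tabulate g))
  sumFin≡edgeSum g = trans (sumFin-tabulate (λ i → coord x (a i) (g i)) (λ i → i))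
                           (sym (trans (cong (edgeSum x) (zip-tabulate a g))
                                       (cong sumQ (List.map-tabulate (λ i → a i , g i) (uncurry (coord x))))))
  matched : sumFin k (λ i → coord x (a i) (b i)) ≡ edgeSum x (evens (edges (wordOf D)))
  matched = begin
    sumFin k (λ i → coord x (a i) (b i))  ≡⟨ sumFin≡edgeSum b ⟩
    edgeSum x (zip As Bs)                   ≡⟨ edgeSum-swap x (zip As Bs) ⟨
    edgeSum x (map swap (zip As Bs))        ≡⟨ cong (edgeSum x) (List.zip-flip Bs As) ⟨
    edgeSum x (zip Bs As)                   ≡⟨ cong (edgeSum x) (cong₂ zip (evens-interleave Bs As |B|≡|A|)
                                                                        (odds-interleave Bs As |B|≡|A|)) ⟨
    edgeSum x (zip (evens (wordOf D)) (odds (wordOf D)))  ≡⟨ cong (edgeSum x) (evens-edges evn) ⟨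
    edgeSum x (evens (edges (wordOf D)))  ∎
    where open ≡-Reasoning
  shifted : sumFin k (λ i → coord x (a i) (b (next i))) ≡ edgeSum x (odds (edges (wordOf D)))
  shifted = begin
    sumFin k (λ i → coord x (a i) (b (next i)))  ≡⟨ sumFin≡edgeSum (b ∘ next) ⟩
    edgeSum x (zip As (tabulate (b ∘ next)))      ≡⟨ cong (λ bs → edgeSum x (zip As bs)) (tabulate-next k b) ⟩
    edgeSum x (zip As (rotate Bs))                 ≡⟨ cong (edgeSum x) (cong₂ (λ as bs → zip as (rotate bs))
                                                      (odds-interleave Bs As |B|≡|A|) (evens-interleave Bs As |B|≡|A|)) ⟨
    edgeSum x (zip (odds (wordOf D)) (rotate (evens (wordOf D))))  ≡⟨ cong (edgeSum x) (odds-edges evn) ⟨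
    edgeSum x (odds (edges (wordOf D)))          ∎
    where open ≡-Reasoning

-- Canonical cycles

-- A cycle of length 2 (k′ + 2) written from its largest vertex, towards the smaller of its neighbours.
record Canonical {n} (w : List (Fin n)) : Set where
  constructor mkCanonical
  field
    top second last : Fin n
    middle          : List (Fin n)
    k′              : ℕ
    shape           : w ≡ top ∷ second ∷ middle ∷ʳ last
    length-middle   : length middle ≡ suc (k′ + k′)
    unique          : Unique w
    below-top       : All (Fin._< top) (second ∷ middle ∷ʳ last)
    second<last     : second Fin.< last

private
  length-∷∷-∷ʳ : (x y z : A) (xs : List A) → length (x ∷ y ∷ xs ∷ʳ z) ≡ 3 + length xs
  length-∷∷-∷ʳ x y z xs = cong (ℕ.suc ∘ ℕ.suc) (trans (List.length-++ xs) (ℕ.+-comm (length xs) 1))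

  K+K : ∀ k′ → suc (suc k′) + suc (suc k′) ≡ 3 + suc (k′ + k′)
  K+K = solve-∀

length-canonical : {w : List (Fin n)} (c : Canonical w) →
                   let K = suc (suc (Canonical.k′ c)) in length w ≡ K + K
length-canonical (mkCanonical M u v middle k′ refl length-middle _ _ _) =
  trans (length-∷∷-∷ʳ M u v middle) (trans (cong (3 +_) length-middle) (sym (K+K k′)))

k′-unique : {w : List (Fin n)} (c c′ : Canonical w) → Canonical.k′ c ≡ Canonical.k′ c′
k′-unique c c′ =
  ℕ.suc-injective (ℕ.suc-injective (half-injective (trans (sym (length-canonical c)) (length-canonical c′))))
  where
  half-injective : ∀ {a b} → a + a ≡ b + b → a ≡ b
  half-injective {a} {b} e = ℕ.*-cancelˡ-≡ a b 2
    (trans (cong (a +_) (ℕ.+-identityʳ a)) (trans e (cong (b +_) (sym (ℕ.+-identityʳ b)))))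

Unique⇒length≤ : {xs : List (Fin n)} → Unique xs → length xs ℕ.≤ n
Unique⇒length≤ unq = Fin.injective⇒≤ (lookup-injective unq)

k′<n/2∸1 : {w : List (Fin n)} (c : Canonical w) → Canonical.k′ c ℕ.< n / 2 ∸ 1
k′<n/2∸1 {n} {w} c = ℕ.∸-monoˡ-≤ 1 (subst (ℕ._≤ n / 2) (m*n/n≡m K 2) (/-monoˡ-≤ 2 K*2≤n))
  where
  K = suc (suc (Canonical.k′ c))
  K*2≤n : K ℕ.* 2 ℕ.≤ n
  K*2≤n = subst (ℕ._≤ n) (trans (length-canonical c) (trans (cong (K +_) (sym (ℕ.+-identityʳ K))) (ℕ.*-comm 2 K)))
                (Unique⇒length≤ (Canonical.unique c))

EvenLength-canonical : {w : List (Fin n)} → Canonical w → EvenLength w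
EvenLength-canonical c = EvenLength-length (suc (suc (Canonical.k′ c))) (length-canonical c)

2≤length-evens : {w : List (Fin n)} → Canonical w → 2 ℕ.≤ length (evens w)
2≤length-evens (mkCanonical _ _ _ (_ ∷ _) _ refl _ _ _ _) = s≤s (s≤s z≤n)

module _ {w : List (Fin n)} (c : Canonical w) where
  open Canonical c

  private
    |B|≡|A| : length (evens w) ≡ length (odds w)
    |B|≡|A| = length-evens (EvenLength-canonical c)

    unique-B++A : Unique (evens w ++ odds w)
    unique-B++A = Unique-resp-↭ (↭-sym (↭-evens-++-odds w)) unique

  toWData : WData n
  toWData = record
    { k     = length (evens w)
    ; 2≤k   = 2≤length-evens c
    ; k≤n   = Fin.injective⇒≤ b-inj
    ; a     = lookup (odds w) ∘ cast |B|≡|A|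
    ; b     = lookup (evens w)
    ; a-inj = cast-injective ∘ lookup-injective (Unique-++⁻ʳ (evens w) unique-B++A)
    ; b-inj = b-inj
    ; a≢b   = λ i j e → Unique-++⁻-disjoint (evens w) unique-B++A (∈-lookup j) (subst (_∈ odds w) e (∈-lookup _))
    }
    where
    b-inj = lookup-injective (Unique-++⁻ˡ (evens w) unique-B++A)
    cast-injective : ∀ {i j} → cast |B|≡|A| i ≡ cast |B|≡|A| j → i ≡ j
    cast-injective {i} {j} e = Fin.toℕ-injective
      (trans (sym (Fin.toℕ-cast |B|≡|A| i)) (trans (cong Fin.toℕ e) (Fin.toℕ-cast |B|≡|A| j)))

  wordOf-toWData : wordOf toWData ≡ w
  wordOf-toWData = begin
    interleave (tabulate (lookup (evens w))) (tabulate (lookup (odds w) ∘ cast |B|≡|A|))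
      ≡⟨ cong₂ interleave (List.tabulate-lookup (evens w)) (tabulate-lookup-cast (odds w) |B|≡|A|) ⟩
    interleave (evens w) (odds w)
      ≡⟨ interleave-evens-odds w ⟩
    w ∎
    where open ≡-Reasoning

SameCycle : List (Fin n) → List (Fin n) → Set
SameCycle w′ w = w′ ↭ w × (∀ x → CycleHyp w′ x ⇔ CycleHyp w x)

SameCycle-trans : {w₁ w₂ w₃ : List (Fin n)} → SameCycle w₁ w₂ → SameCycle w₂ w₃ → SameCycle w₁ w₃
SameCycle-trans (p , h) (q , g) = ↭-trans p q , λ x → ⇔.trans (h x) (g x)

SameCycle-rotate^ : ∀ i {w : List (Fin n)} → EvenLength w → SameCycle (rotate^ i w) w
SameCycle-rotate^ zero    evn = ↭-refl , λ x → ⇔.refl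
SameCycle-rotate^ (suc i) {w} evn =
  SameCycle-trans (SameCycle-rotate^ i (EvenLength-resp-length evn (sym (length-rotate w))))
                  (↭-rotate w , λ x → CycleHyp-rotate x evn)

SameCycle-reflect : (v : Fin n) {t : List (Fin n)} → EvenLength (v ∷ t) → SameCycle (v ∷ reverse t) (v ∷ t)
SameCycle-reflect v {t} evn = ↭-prep v (↭.↭-reverse t) , λ x → CycleHyp-reflect v x evn

∃-maximum : (x : Fin n) (xs : List (Fin n)) → ∃ λ M → M ∈ x ∷ xs × All (Fin._≤ M) (x ∷ xs)
∃-maximum x []       = x , here refl , Fin.≤-refl ∷ []
∃-maximum x (y ∷ ys) with ∃-maximum y ys
... | M , M∈ , ≤M with Fin.≤-total x M
...   | inj₁ x≤M = M , there M∈ , x≤M ∷ ≤M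
...   | inj₂ M≤x = x , here refl , Fin.≤-refl ∷ All.map (λ y≤M → Fin.≤-trans y≤M M≤x) ≤M

rotate-to-front : {M : Fin n} {w : List (Fin n)} → EvenLength w → M ∈ w → ∃ λ t → SameCycle (M ∷ t) w
rotate-to-front {M = M} evn M∈w with ∈-∃++ M∈w
... | P , Q , refl = Q ++ P , subst (λ w′ → SameCycle w′ (P ++ M ∷ Q)) (rotate^-++ P (M ∷ Q))
                                    (SameCycle-rotate^ (length P) evn)

orient : (M u v : Fin n) (mid : List (Fin n)) {w : List (Fin n)} → Unique w → EvenLength w →
         SameCycle (M ∷ u ∷ mid ∷ʳ v) w →
         ∃ λ u′ → ∃ λ v′ → ∃ λ mid′ →
           u′ Fin.< v′ × length mid′ ≡ length mid × SameCycle (M ∷ u′ ∷ mid′ ∷ʳ v′) w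
orient M u v mid unq evn M∷t∼w with Fin.<-cmp u v
... | tri< u<v _ _ = u , v , mid , u<v , refl , M∷t∼w
... | tri≈ _ refl _ with Unique-resp-↭ (↭-sym (proj₁ M∷t∼w)) unq
...   | _ ∷ u∉ ∷ _ = ⊥-elim (All.lookup u∉ (∈-++⁺ʳ mid (here refl)) refl)
orient M u v mid unq evn M∷t∼w | tri> _ _ v<u =
  v , u , reverse mid , v<u , List.length-reverse mid ,
  SameCycle-trans (subst (λ t → SameCycle (M ∷ t) (M ∷ u ∷ mid ∷ʳ v)) reverse-u∷mid∷v
                         (SameCycle-reflect M evn′))
                  M∷t∼w
  where
  evn′ : EvenLength (M ∷ u ∷ mid ∷ʳ v)
  evn′ = EvenLength-resp-length evn (sym (↭.↭-length (proj₁ M∷t∼w)))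
  reverse-u∷mid∷v : reverse (u ∷ mid ∷ʳ v) ≡ v ∷ reverse mid ∷ʳ u
  reverse-u∷mid∷v = trans (List.unfold-reverse u (mid ∷ʳ v)) (cong (_∷ʳ u) (List.reverse-++ mid [ v ]))

private
  split-ends : ∀ {m} (t : List A) → length t ≡ suc (suc m) →
               ∃ λ u → ∃ λ mid → ∃ λ v → t ≡ u ∷ mid ∷ʳ v
  split-ends (u ∷ y ∷ ys) _ with split-last y ys
  ... | mid , v , e = u , mid , v , cong (u ∷_) e

canonicalize : (k′ : ℕ) (w : List (Fin n)) → length w ≡ suc (suc k′) + suc (suc k′) → Unique w →
               ∃ λ w′ → Canonical w′ × SameCycle w′ w
canonicalize k′ (x ∷ xs) |w| unq with ∃-maximum x xs
... | M , M∈w , ≤M with rotate-to-front (EvenLength-length (suc (suc k′)) |w|) M∈w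
... | t , M∷t∼w with split-ends t (ℕ.suc-injective |M∷t|)
  where
  |M∷t| : length (M ∷ t) ≡ 3 + suc (k′ + k′)
  |M∷t| = trans (↭.↭-length (proj₁ M∷t∼w)) (trans |w| (K+K k′))
... | u , mid , v , refl with orient M u v mid unq (EvenLength-length (suc (suc k′)) |w|) M∷t∼w
... | u′ , v′ , mid′ , u′<v′ , |mid′| , M∷t′∼w =
  M ∷ u′ ∷ mid′ ∷ʳ v′ ,
  mkCanonical M u′ v′ mid′ k′ refl |mid′|≡ unq′ (All.tabulate below-M) u′<v′ ,
  M∷t′∼w
  where
  unq′ : Unique (M ∷ u′ ∷ mid′ ∷ʳ v′)
  unq′ = Unique-resp-↭ (↭-sym (proj₁ M∷t′∼w)) unq
  |mid′|≡ : length mid′ ≡ suc (k′ + k′)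
  |mid′|≡ = trans |mid′| (ℕ.suc-injective (ℕ.suc-injective (ℕ.suc-injective
              (trans (sym (length-∷∷-∷ʳ M u v mid))
                     (trans (↭.↭-length (proj₁ M∷t∼w)) (trans |w| (K+K k′)))))))
  below-M : ∀ {y} → y ∈ u′ ∷ mid′ ∷ʳ v′ → y Fin.< M
  below-M {y} y∈ with unq′
  ... | M∉ ∷ _ = Fin.≤∧≢⇒< (All.lookup ≤M (↭.∈-resp-↭ (proj₁ M∷t′∼w) (there y∈)))
                           (λ y≡M → All.lookup M∉ y∈ (sym y≡M))

H-toWData : {w : List (Fin n)} (c : Canonical w) (x : Point n) → H (toWData c) x ≡ CycleHyp w x
H-toWData c x = trans (H≡CycleHyp-wordOf (toWData c) x) (cong (λ w → CycleHyp w x) (wordOf-toWData c))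

canonical-form : (D : WData n) → ∃ λ w → Canonical w × (∀ x → H D x ⇔ CycleHyp w x)
canonical-form D with canonicalize (k ∸ 2) (wordOf D) |wordOf-D| (Unique-wordOf D)
  where
  open WData D
  |wordOf-D| : length (wordOf D) ≡ suc (suc (k ∸ 2)) + suc (suc (k ∸ 2))
  |wordOf-D| = trans (length-wordOf D) (cong (λ m → m + m) (sym (ℕ.m+[n∸m]≡n 2≤k)))
... | w , c , _ , same = w , c , λ x → ⇔.trans (≡⇒⇔ (H≡CycleHyp-wordOf D x)) (⇔.sym (same x))

-- Indicator vectors recover the edges of a cycle

_∈ᵤ_ : Edge n → List (Edge n) → Set
e ∈ᵤ es = e ∈ es ⊎ swap e ∈ es

private
  _≟ₑ_ : DecidableEquality (Edge n)
  _≟ₑ_ = ≡-dec Fin._≟_ Fin._≟_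

_∈ᵤ?_ : (e : Edge n) (es : List (Edge n)) → Dec (e ∈ᵤ es)
e ∈ᵤ? es = (e ∈? es) ⊎-dec (swap e ∈? es)
  where open DecMembership _≟ₑ_

_≈ᵤ_ : Edge n → Edge n → Set
e ≈ᵤ f = e ≡ f ⊎ swap e ≡ f

_≈ᵤ?_ : (e f : Edge n) → Dec (e ≈ᵤ f)
e ≈ᵤ? f = (e ≟ₑ f) ⊎-dec (swap e ≟ₑ f)

≈ᵤ-swap : {e f : Edge n} → e ≈ᵤ f → e ≈ᵤ swap f
≈ᵤ-swap (inj₁ refl) = inj₂ refl
≈ᵤ-swap (inj₂ refl) = inj₁ refl

iverson : {P : Set} → Dec P → ℚ
iverson (yes _) = 1ℚ
iverson (no _)  = 0ℚ

iverson-cong : {P Q : Set} → (P → Q) → (Q → P) → (p : Dec P) (q : Dec Q) → iverson p ≡ iverson q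
iverson-cong _   _   (yes _) (yes _) = refl
iverson-cong _   _   (no _)  (no _)  = refl
iverson-cong p→q _   (yes p) (no ¬q) = ⊥-elim (¬q (p→q p))
iverson-cong _   q→p (no ¬p) (yes q) = ⊥-elim (¬p (q→p q))

iverson-yes : {P : Set} (p : Dec P) → P → iverson p ≡ 1ℚ
iverson-yes (yes _) _ = refl
iverson-yes (no ¬p) p = ⊥-elim (¬p p)

iverson-no : {P : Set} (p : Dec P) → ¬ P → iverson p ≡ 0ℚ
iverson-no (yes p) ¬p = ⊥-elim (¬p p)
iverson-no (no _)  _  = refl

indicator : Edge n → Point n
indicator e i j = iverson (e ≈ᵤ? (i , j))

private
  coord-indicator : (e : Edge n) (f : Edge n) → uncurry (coord (indicator e)) f ≡ iverson (e ≈ᵤ? f)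
  coord-indicator e (i , j) with toℕ i ℕ.<ᵇ toℕ j
  ... | true  = refl
  ... | false = iverson-cong ≈ᵤ-swap ≈ᵤ-swap (e ≈ᵤ? (j , i)) (e ≈ᵤ? (i , j))

  0≤iverson : {P : Set} (p : Dec P) → 0ℚ ℚ.≤ iverson p
  0≤iverson (yes _) = ℚ.<⇒≤ (ℚ.positive⁻¹ 1ℚ)
  0≤iverson (no _)  = ℚ.≤-refl

0≤edgeSum-indicator : (e : Edge n) (es : List (Edge n)) → 0ℚ ℚ.≤ edgeSum (indicator e) es
0≤edgeSum-indicator e []       = ℚ.≤-refl
0≤edgeSum-indicator e (f ∷ es) = subst (ℚ._≤ edgeSum (indicator e) (f ∷ es)) (ℚ.+-identityˡ 0ℚ)
  (ℚ.+-mono-≤ (subst (0ℚ ℚ.≤_) (sym (coord-indicator e f)) (0≤iverson (e ≈ᵤ? f))) (0≤edgeSum-indicator e es))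

0<edgeSum-indicator : (e : Edge n) (es : List (Edge n)) → e ∈ᵤ es → 0ℚ ℚ.< edgeSum (indicator e) es
0<edgeSum-indicator e es e∈es = go es (Any.Any-⊎⁺ e∈es)
  where
  go : (es : List (Edge _)) → Any (e ≈ᵤ_) es → 0ℚ ℚ.< edgeSum (indicator e) es
  go (f ∷ es) (here e≈f) = subst (ℚ._< edgeSum (indicator e) (f ∷ es)) (ℚ.+-identityˡ 0ℚ)
    (ℚ.+-mono-<-≤ 0<f (0≤edgeSum-indicator e es))
    where
    0<f : 0ℚ ℚ.< uncurry (coord (indicator e)) f
    0<f = subst (0ℚ ℚ.<_) (sym (trans (coord-indicator e f) (iverson-yes (e ≈ᵤ? f) e≈f))) (ℚ.positive⁻¹ 1ℚ)
  go (f ∷ es) (there p)  = subst (ℚ._< edgeSum (indicator e) (f ∷ es)) (ℚ.+-identityˡ 0ℚ)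
    (ℚ.+-mono-≤-< (subst (0ℚ ℚ.≤_) (sym (coord-indicator e f)) (0≤iverson (e ≈ᵤ? f))) (go es p))

edgeSum-indicator-∉ : (e : Edge n) (es : List (Edge n)) → ¬ e ∈ᵤ es → edgeSum (indicator e) es ≡ 0ℚ
edgeSum-indicator-∉ e []       _    = refl
edgeSum-indicator-∉ e (f ∷ es) e∉es = begin
  uncurry (coord (indicator e)) f ℚ.+ edgeSum (indicator e) es  ≡⟨ cong₂ ℚ._+_ f-value rest ⟩
  0ℚ ℚ.+ 0ℚ                                                     ≡⟨ ℚ.+-identityˡ 0ℚ ⟩
  0ℚ                                                          ∎
  where
  open ≡-Reasoning
  e≉f : ¬ e ≈ᵤ f
  e≉f (inj₁ e≡f)  = e∉es (inj₁ (here e≡f))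
  e≉f (inj₂ e′≡f) = e∉es (inj₂ (here e′≡f))
  f-value = trans (coord-indicator e f) (iverson-no (e ≈ᵤ? f) e≉f)
  rest = edgeSum-indicator-∉ e es (λ { (inj₁ p) → e∉es (inj₁ (there p)) ; (inj₂ p) → e∉es (inj₂ (there p)) })

private
  ∈ᵤ-map : {xs ys : List (Edge n)} {e : Edge n} → (∀ {f} → f ∈ xs → f ∈ ys) → e ∈ᵤ xs → e ∈ᵤ ys
  ∈ᵤ-map xs⊆ys (inj₁ p) = inj₁ (xs⊆ys p)
  ∈ᵤ-map xs⊆ys (inj₂ p) = inj₂ (xs⊆ys p)

  ∈ᵤ-evens-or-odds : {es : List (Edge n)} {e : Edge n} → e ∈ᵤ es → e ∈ᵤ evens es ⊎ e ∈ᵤ odds es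
  ∈ᵤ-evens-or-odds {es = es} (inj₁ p) with ∈-++⁻ (evens es) (↭.∈-resp-↭ (↭-sym (↭-evens-++-odds es)) p)
  ... | inj₁ q = inj₁ (inj₁ q)
  ... | inj₂ q = inj₂ (inj₁ q)
  ∈ᵤ-evens-or-odds {es = es} (inj₂ p) with ∈-++⁻ (evens es) (↭.∈-resp-↭ (↭-sym (↭-evens-++-odds es)) p)
  ... | inj₁ q = inj₁ (inj₂ q)
  ... | inj₂ q = inj₂ (inj₂ q)

  ∈-evens⇒∈ : {es : List (Edge n)} {f : Edge n} → f ∈ evens es → f ∈ es
  ∈-evens⇒∈ {es = es} p = ↭.∈-resp-↭ (↭-evens-++-odds es) (∈-++⁺ˡ p)

  ∈-odds⇒∈ : {es : List (Edge n)} {f : Edge n} → f ∈ odds es → f ∈ es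
  ∈-odds⇒∈ {es = es} p = ↭.∈-resp-↭ (↭-evens-++-odds es) (∈-++⁺ʳ (evens es) p)

-- Edges in even positions run from B to A, those in odd positions from A to the next vertex of B;
-- an edge of both kinds would put a vertex in both B and A, or join a vertex of B to itself.
alternating-exclusive : {B A : List (Fin n)} {e : Edge n} → Unique (B ++ A) → 2 ≤ length B →
                        e ∈ᵤ zip B A → ¬ e ∈ᵤ zip A (rotate B)
alternating-exclusive {B = B} unq _  (inj₁ p) (inj₁ q) = Unique-++⁻-disjoint B unq (∈-zip⁻ˡ p) (∈-zip⁻ˡ q)
alternating-exclusive {B = B} unq 2≤ (inj₁ p) (inj₂ q) =
  edges-loopless (Unique-++⁻ˡ B unq) 2≤ (∈-zip-pivot (Unique-++⁻ʳ B unq) (∈-zip-swap p) q)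
alternating-exclusive {B = B} unq 2≤ (inj₂ p) (inj₁ q) =
  edges-loopless (Unique-++⁻ˡ B unq) 2≤ (∈-zip-pivot (Unique-++⁻ʳ B unq) (∈-zip-swap p) q)
alternating-exclusive {B = B} unq _  (inj₂ p) (inj₂ q) = Unique-++⁻-disjoint B unq (∈-zip⁻ˡ p) (∈-zip⁻ˡ q)

module _ {w : List (Fin n)} (unq : Unique w) (evn : EvenLength w) (2≤ : 2 ≤ length (evens w)) where

  private
    unq-B++A : Unique (evens w ++ odds w)
    unq-B++A = Unique-resp-↭ (↭-sym (↭-evens-++-odds w)) unq

    evens⇒¬odds : {e : Edge n} → e ∈ᵤ evens (edges w) → ¬ e ∈ᵤ odds (edges w)
    evens⇒¬odds p q = alternating-exclusive unq-B++A 2≤ (subst (_ ∈ᵤ_) (evens-edges evn) p)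
                                                         (subst (_ ∈ᵤ_) (odds-edges evn) q)

  CycleHyp-indicator-∈ : {e : Edge n} → e ∈ᵤ edges w → ¬ CycleHyp w (indicator e)
  CycleHyp-indicator-∈ {e} e∈E hyp with ∈ᵤ-evens-or-odds e∈E
  ... | inj₁ e∈evens = ℚ.<⇒≢ (0<edgeSum-indicator e _ e∈evens)
                         (sym (trans hyp (edgeSum-indicator-∉ e _ (evens⇒¬odds e∈evens))))
  ... | inj₂ e∈odds  = ℚ.<⇒≢ (0<edgeSum-indicator e _ e∈odds)
                         (sym (trans (sym hyp) (edgeSum-indicator-∉ e _ (λ e∈evens → evens⇒¬odds e∈evens e∈odds))))

  CycleHyp-indicator-∉ : {e : Edge n} → ¬ e ∈ᵤ edges w → CycleHyp w (indicator e)
  CycleHyp-indicator-∉ {e} e∉E = trans (edgeSum-indicator-∉ e _ (e∉E ∘ ∈ᵤ-map ∈-evens⇒∈))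
                                        (sym (edgeSum-indicator-∉ e _ (e∉E ∘ ∈ᵤ-map ∈-odds⇒∈)))

same-CycleHyp⇒same-edges : {w₁ w₂ : List (Fin n)} → Canonical w₁ → Canonical w₂ →
                           (∀ x → CycleHyp w₁ x ⇔ CycleHyp w₂ x) → ∀ {e} → e ∈ᵤ edges w₁ → e ∈ᵤ edges w₂
same-CycleHyp⇒same-edges {w₂ = w₂} c₁ c₂ same {e} e∈E₁ with e ∈ᵤ? edges w₂
... | yes e∈E₂ = e∈E₂
... | no  e∉E₂ = ⊥-elim (CycleHyp-indicator-∈ (unique c₁) (EvenLength-canonical c₁) (2≤length-evens c₁) e∈E₁
                   (Equivalence.from (same (indicator e))
                     (CycleHyp-indicator-∉ (unique c₂) (EvenLength-canonical c₂) (2≤length-evens c₂) e∉E₂)))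
  where open Canonical using (unique)

private
  vertex-of-edge : (w : List (Fin n)) {p q : Fin n} → (p , q) ∈ᵤ edges w → p ∈ w
  vertex-of-edge w (inj₁ pq∈) = ∈-zip⁻ˡ pq∈
  vertex-of-edge w (inj₂ qp∈) = ↭.∈-resp-↭ (↭-rotate w) (∈-zip⁻ʳ qp∈)

-- {y,h} cannot join y to its predecessor in the second word: that vertex lies in M ∷ P, and h does not.
successor-agrees : ∀ {M y h : Fin n} P {t₁ s₂ : List (Fin n)} →
                   Unique (M ∷ P ++ y ∷ h ∷ t₁) → Unique (M ∷ P ++ y ∷ s₂) →
                   (y , h) ∈ᵤ edges (M ∷ P ++ y ∷ s₂) → ∃ λ t₂ → s₂ ≡ h ∷ t₂
successor-agrees {M = M} {y} {h} P {s₂ = []} (M∉ ∷ _) unq₂ (inj₁ yh∈) =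
  ⊥-elim (All.lookup M∉ (∈-++⁺ʳ P (there (here refl))) (sym (edges-functionalˡ unq₂ yh∈ (∈-edges-wrap M P y))))
successor-agrees {M = M} P {s₂ = h′ ∷ t₂} _ unq₂ (inj₁ yh∈) =
  t₂ , cong (_∷ t₂) (sym (edges-functionalˡ unq₂ yh∈ (∈-edges-adjacent (M ∷ P))))
successor-agrees {M = M} {y} {h} P {t₁} {s₂} unq₁ unq₂ (inj₂ hy∈) with split-last M P
... | Pre , p , M∷P≡Pre∷p = ⊥-elim (Unique-++⁻-disjoint (M ∷ P) unq₁ h∈M∷P (there (here refl)))
  where
  py∈ : (p , y) ∈ edges (M ∷ P ++ y ∷ s₂)
  py∈ = subst (λ w → (p , y) ∈ edges w)
              (trans (sym (List.++-assoc Pre [ p ] (y ∷ s₂))) (cong (_++ y ∷ s₂) (sym M∷P≡Pre∷p)))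
              (∈-edges-adjacent Pre)
  h∈M∷P : h ∈ M ∷ P
  h∈M∷P = subst (_∈ M ∷ P) (sym (edges-functionalʳ unq₂ hy∈ py∈))
                (subst (p ∈_) (sym M∷P≡Pre∷p) (∈-++⁺ʳ Pre (here refl)))

edges-walk : ∀ {M : Fin n} {T₁ T₂ : List (Fin n)} → Unique (M ∷ T₁) → Unique (M ∷ T₂) →
             (∀ {e} → e ∈ᵤ edges (M ∷ T₁) → e ∈ᵤ edges (M ∷ T₂)) →
             (∀ {e} → e ∈ᵤ edges (M ∷ T₂) → e ∈ᵤ edges (M ∷ T₁)) →
             ∀ P y {s₁ s₂} → T₁ ≡ P ++ y ∷ s₁ → T₂ ≡ P ++ y ∷ s₂ → s₁ ≡ s₂
edges-walk unq₁ unq₂ ⊆₁₂ ⊆₂₁ P y {[]} {[]} _ _ = refl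
edges-walk {M = M} unq₁ unq₂ ⊆₁₂ ⊆₂₁ P y {[]} {h ∷ t₂} refl refl
  with successor-agrees P unq₂ unq₁ (⊆₂₁ (inj₁ (∈-edges-adjacent (M ∷ P))))
... | _ , ()
edges-walk {M = M} unq₁ unq₂ ⊆₁₂ ⊆₂₁ P y {h ∷ t₁} refl refl
  with successor-agrees P unq₁ unq₂ (⊆₁₂ (inj₁ (∈-edges-adjacent (M ∷ P))))
... | t₂ , refl = cong (h ∷_) (edges-walk unq₁ unq₂ ⊆₁₂ ⊆₂₁ (P ∷ʳ y) h
                                (sym (List.++-assoc P [ y ] (h ∷ t₁))) (sym (List.++-assoc P [ y ] (h ∷ t₂))))

canonical-edges-injective : {w₁ w₂ : List (Fin n)} → Canonical w₁ → Canonical w₂ →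
                            (∀ {e} → e ∈ᵤ edges w₁ → e ∈ᵤ edges w₂) → (∀ {e} → e ∈ᵤ edges w₂ → e ∈ᵤ edges w₁) →
                            w₁ ≡ w₂
canonical-edges-injective (mkCanonical M₁ u₁ v₁ mid₁ _ refl _ unq₁ <M₁ u₁<v₁)
                          (mkCanonical M₂ u₂ v₂ mid₂ _ refl _ unq₂ <M₂ u₂<v₂) ⊆₁₂ ⊆₂₁ with M₁≡M₂
  where
  M₁≡M₂ : M₁ ≡ M₂
  M₁≡M₂ with vertex-of-edge (M₂ ∷ u₂ ∷ mid₂ ∷ʳ v₂) (⊆₁₂ (inj₁ (here refl)))
             | vertex-of-edge (M₁ ∷ u₁ ∷ mid₁ ∷ʳ v₁) (⊆₂₁ (inj₁ (here refl)))
  ... | here M₁≡M₂ | _           = M₁≡M₂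
  ... | there _    | here M₂≡M₁  = sym M₂≡M₁
  ... | there M₁∈  | there M₂∈   = ⊥-elim (Fin.<-asym (All.lookup <M₂ M₁∈) (All.lookup <M₁ M₂∈))
... | refl with u₁≡u₂
  where
  M = M₁
  u₁-position : u₁ ≡ u₂ ⊎ u₁ ≡ v₂
  u₁-position with ⊆₁₂ (inj₁ (here refl))
  ... | inj₁ Mu₁∈ = inj₁ (edges-functionalˡ unq₂ Mu₁∈ (here refl))
  ... | inj₂ u₁M∈ = inj₂ (edges-functionalʳ unq₂ u₁M∈ (∈-edges-wrap M (u₂ ∷ mid₂) v₂))
  u₂-position : u₂ ≡ u₁ ⊎ u₂ ≡ v₁
  u₂-position with ⊆₂₁ (inj₁ (here refl))
  ... | inj₁ Mu₂∈ = inj₁ (edges-functionalˡ unq₁ Mu₂∈ (here refl))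
  ... | inj₂ u₂M∈ = inj₂ (edges-functionalʳ unq₁ u₂M∈ (∈-edges-wrap M (u₁ ∷ mid₁) v₁))
  u₁≡u₂ : u₁ ≡ u₂
  u₁≡u₂ with u₁-position | u₂-position
  ... | inj₁ u₁≡u₂ | _          = u₁≡u₂
  ... | inj₂ _     | inj₁ u₂≡u₁ = sym u₂≡u₁
  ... | inj₂ u₁≡v₂ | inj₂ u₂≡v₁ = ⊥-elim (Fin.<-asym u₁<v₁ (subst₂ Fin._<_ u₂≡v₁ (sym u₁≡v₂) u₂<v₂))
... | refl = cong (λ t → M₁ ∷ u₁ ∷ t) (edges-walk unq₁ unq₂ ⊆₁₂ ⊆₂₁ [] u₁ refl refl)

SameHyp-sym : {D E : WData n} → SameHyp D E → SameHyp E D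
SameHyp-sym same x = Product.swap (same x)

SameHyp-toWData⇒≡ : {w₁ w₂ : List (Fin n)} (c₁ : Canonical w₁) (c₂ : Canonical w₂) →
                    SameHyp (toWData c₁) (toWData c₂) → w₁ ≡ w₂
SameHyp-toWData⇒≡ {w₁ = w₁} {w₂} c₁ c₂ same = canonical-edges-injective c₁ c₂
  (same-CycleHyp⇒same-edges c₁ c₂ same-CycleHyp) (same-CycleHyp⇒same-edges c₂ c₁ (⇔.sym ∘ same-CycleHyp))
  where
  same-CycleHyp : ∀ x → CycleHyp w₁ x ⇔ CycleHyp w₂ x
  same-CycleHyp x = ⇔.trans (≡⇒⇔ (sym (H-toWData c₁ x)))
                            (⇔.trans (mk⇔ (proj₁ (same x)) (proj₂ (same x))) (≡⇒⇔ (H-toWData c₂ x)))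

-- Enumerations: selections and arrangements

∈-concatMap⁻′ : (f : A → List B) {xs : List A} {y : B} → y ∈ concatMap f xs → ∃ λ x → x ∈ xs × y ∈ f x
∈-concatMap⁻′ f {xs} = find ∘ ∈-concatMap⁻ f {xs = xs}

∈-concatMap⁺′ : (f : A → List B) {xs : List A} {x : A} {y : B} → x ∈ xs → y ∈ f x → y ∈ concatMap f xs
∈-concatMap⁺′ f x∈ y∈ = ∈-concatMap⁺ f (lose x∈ y∈)

length-concatMap : (f : A → List B) (xs : List A) → length (concatMap f xs) ≡ sum (map (length ∘ f) xs)
length-concatMap f []       = refl
length-concatMap f (x ∷ xs) = trans (List.length-++ (f x)) (cong (length (f x) +_) (length-concatMap f xs))

length-concatMap-const : (f : A → List B) (xs : List A) {c : ℕ} → (∀ {x} → x ∈ xs → length (f x) ≡ c) →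
                         length (concatMap f xs) ≡ length xs * c
length-concatMap-const f []       _   = refl
length-concatMap-const f (x ∷ xs) |f| =
  trans (List.length-++ (f x)) (cong₂ _+_ (|f| (here refl)) (length-concatMap-const f xs (|f| ∘ there)))

Unique-concatMap⁺ : {K : Set} {f : A → List B} (g : A → K) {xs : List A} → Unique (map g xs) →
                    (∀ {x} → x ∈ xs → Unique (f x)) →
                    (∀ {x x′ y} → y ∈ f x → y ∈ f x′ → g x ≡ g x′) → Unique (concatMap f xs)
Unique-concatMap⁺ g unq unq-f separated =
  Unique.concat⁺ (All.map⁺ (All.tabulate unq-f))
                 (AllPairs.map⁺ (AllPairs.map (λ gx≢gx′ {_} (y∈ , y∈′) → gx≢gx′ (separated y∈ y∈′))
                                              (AllPairs.map⁻ unq)))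

∈-map-∷-head : {x x′ : A} {xss xss′ : List (List A)} {ys : List A} →
               ys ∈ map (x ∷_) xss → ys ∈ map (x′ ∷_) xss′ → x ≡ x′
∈-map-∷-head p p′ with ∈-map⁻ _ p | ∈-map⁻ _ p′
... | _ , _ , refl | _ , _ , e = List.∷-injectiveˡ e

AllPairs-lookup : {R : A → A → Set} {xs : List A} → (∀ {x y} → R x y → R y x) → AllPairs R xs →
                  ∀ i j → i ≢ j → R (lookup xs i) (lookup xs j)
AllPairs-lookup {xs = _ ∷ _}  _   _                       zero    zero    i≢j = ⊥-elim (i≢j refl)
AllPairs-lookup {xs = _ ∷ _}  _   (x~xs AllPairs.∷ _)     zero    (suc j) _   = All.lookup x~xs (∈-lookup j)
AllPairs-lookup {xs = _ ∷ _}  symm (x~xs AllPairs.∷ _)    (suc i) zero    _   = symm (All.lookup x~xs (∈-lookup i))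
AllPairs-lookup {xs = _ ∷ _}  symm (_ AllPairs.∷ pairwise) (suc i) (suc j) i≢j =
  AllPairs-lookup symm pairwise i j (i≢j ∘ cong suc)

map-proj₁-toList : {P : A → Set} {xs : List A} (ps : All P xs) → map proj₁ (All.toList ps) ≡ xs
map-proj₁-toList []       = refl
map-proj₁-toList (p ∷ ps) = cong (_ ∷_) (map-proj₁-toList ps)

∈-toList : {P : A → Set} {xs : List A} {x : A} (ps : All P xs) → x ∈ xs → ∃ λ px → (x , px) ∈ All.toList ps
∈-toList (p ∷ ps) (here refl) = p , here refl
∈-toList (p ∷ ps) (there x∈) = Product.map₂ there (∈-toList ps x∈)

length-toList : {P : A → Set} {xs : List A} (ps : All P xs) → length (All.toList ps) ≡ length xs
length-toList ps = trans (sym (List.length-map proj₁ (All.toList ps))) (cong length (map-proj₁-toList ps))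

select : List A → List (A × List A)
select []       = []
select (x ∷ xs) = (x , xs) ∷ map (map₂ (x ∷_)) (select xs)

↭-select : {xs : List A} {v : A} {R : List A} → (v , R) ∈ select xs → xs ↭ v ∷ R
↭-select {xs = x ∷ xs} (here refl) = ↭-refl
↭-select {xs = x ∷ xs} (there p) with ∈-map⁻ (map₂ (x ∷_)) p
... | (v , R) , q , refl = ↭-trans (↭-prep x (↭-select q)) (↭-swap x v ↭-refl)

∈-select : {xs : List A} {v : A} → v ∈ xs → ∃ λ R → (v , R) ∈ select xs × (∀ {y} → y ∈ xs → y ≢ v → y ∈ R)
∈-select {xs = x ∷ xs} (here refl) =
  xs , here refl , λ { (here refl) y≢v → ⊥-elim (y≢v refl) ; (there y∈) _ → y∈ }
∈-select {xs = x ∷ xs} (there v∈) with ∈-select v∈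
... | R , p , rest = x ∷ R , there (∈-map⁺ (map₂ (x ∷_)) p) ,
                     λ { (here refl) _ → here refl ; (there y∈) y≢v → there (rest y∈ y≢v) }

map-proj₁-select : (xs : List A) → map proj₁ (select xs) ≡ xs
map-proj₁-select []       = refl
map-proj₁-select (x ∷ xs) = cong (x ∷_) (trans (sym (List.map-∘ (select xs))) (map-proj₁-select xs))

length-select : (xs : List A) → length (select xs) ≡ length xs
length-select xs = trans (sym (List.length-map proj₁ (select xs))) (cong length (map-proj₁-select xs))

fallingFactorial : ℕ → ℕ → ℕ
fallingFactorial m       zero    = 1
fallingFactorial zero    (suc r) = 0
fallingFactorial (suc m) (suc r) = suc m * fallingFactorial m r

arrangements : ℕ → List A → List (List A)
arrangementsWithHead : ℕ → A × List A → List (List A)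
arrangements zero    xs = [ [] ]
arrangements (suc r) xs = concatMap (arrangementsWithHead r) (select xs)
arrangementsWithHead r (v , R) = map (v ∷_) (arrangements r R)

∈-arrangements⁻ : ∀ r {xs ys : List A} → ys ∈ arrangements r xs → length ys ≡ r × ∃ λ R → xs ↭ ys ++ R
∈-arrangements⁻ zero    {xs} (here refl) = refl , xs , ↭-refl
∈-arrangements⁻ (suc r) {xs} p with ∈-concatMap⁻′ (arrangementsWithHead r) {select xs} p
... | (v , R) , vR∈ , q with ∈-map⁻ (v ∷_) q
... | ys , ys∈ , refl with ∈-arrangements⁻ r ys∈
... | |ys| , R′ , R↭ = cong suc |ys| , R′ , ↭-trans (↭-select vR∈) (↭-prep v R↭)

∈-arrangements⁺ : {xs ys : List A} → Unique ys → (∀ {y} → y ∈ ys → y ∈ xs) → ys ∈ arrangements (length ys) xs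
∈-arrangements⁺ {ys = []}     _              _   = here refl
∈-arrangements⁺ {ys = y ∷ ys} (y∉ys ∷ unq) ys⊆ with ∈-select (ys⊆ (here refl))
... | R , yR∈ , rest =
  ∈-concatMap⁺′ (arrangementsWithHead (length ys)) yR∈
    (∈-map⁺ (y ∷_) (∈-arrangements⁺ unq (λ z∈ → rest (ys⊆ (there z∈)) (λ z≡y → All.lookup y∉ys z∈ (sym z≡y)))))

Unique-arrangements : ∀ r {xs : List A} → Unique xs → Unique (arrangements r xs)
Unique-arrangements zero    _   = [] ∷ []
Unique-arrangements (suc r) {xs} unq =
  Unique-concatMap⁺ proj₁ (subst Unique (sym (map-proj₁-select xs)) unq)
    (λ {(v , R)} vR∈ → Unique.map⁺ (proj₂ ∘ List.∷-injective)
                         (Unique-arrangements r (AllPairs.tail (Unique-resp-↭ (↭-select vR∈) unq))))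
    ∈-map-∷-head

length-arrangements : ∀ r (xs : List A) → length (arrangements r xs) ≡ fallingFactorial (length xs) r
length-arrangements zero    xs       = refl
length-arrangements (suc r) []       = refl
length-arrangements (suc r) (x ∷ xs) =
  trans (length-concatMap-const (arrangementsWithHead r) (select (x ∷ xs)) |block|)
        (cong (_* fallingFactorial (length xs) r) (length-select (x ∷ xs)))
  where
  |block| : ∀ {vR} → vR ∈ select (x ∷ xs) → length (arrangementsWithHead r vR) ≡ fallingFactorial (length xs) r
  |block| {v , R} vR∈ = trans (List.length-map (v ∷_) (arrangements r R))
    (trans (length-arrangements r R)
           (cong (λ m → fallingFactorial m r) (ℕ.suc-injective (sym (↭.↭-length (↭-select vR∈))))))

private
  pairWith : A → A × List A → A × A × List A
  pairWith x (v , R) = x , v , R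

  setAside : A → A × A × List A → A × A × List A
  setAside x (u , v , R) = u , v , x ∷ R

select₂ : List A → List (A × A × List A)
select₂ []       = []
select₂ (x ∷ xs) = map (pairWith x) (select xs) ++ map (setAside x) (select₂ xs)

ends : A × A × List A → A × A
ends (u , v , _) = u , v

↭-select₂ : {xs : List A} {u v : A} {R : List A} → (u , v , R) ∈ select₂ xs → xs ↭ u ∷ v ∷ R
↭-select₂ {xs = x ∷ xs} p with ∈-++⁻ (map (pairWith x) (select xs)) p
... | inj₁ q with ∈-map⁻ (pairWith x) q
...   | _ , vR∈ , refl = ↭-prep x (↭-select vR∈)
↭-select₂ {xs = x ∷ xs} p | inj₂ q with ∈-map⁻ (setAside x) q
...   | (u , v , R) , uvR∈ , refl =
  ↭-trans (↭-prep x (↭-select₂ uvR∈)) (↭-trans (↭-swap x u ↭-refl) (↭-prep u (↭-swap x v ↭-refl)))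

select₂-ordered : {_<_ : A → A → Set} {xs : List A} {u v : A} {R : List A} →
                  AllPairs _<_ xs → (u , v , R) ∈ select₂ xs → u < v
select₂-ordered {xs = x ∷ xs} (x<xs AllPairs.∷ sorted) p with ∈-++⁻ (map (pairWith x) (select xs)) p
... | inj₁ q with ∈-map⁻ (pairWith x) q
...   | _ , vR∈ , refl = All.lookup x<xs (↭.∈-resp-↭ (↭-sym (↭-select vR∈)) (here refl))
select₂-ordered {xs = x ∷ xs} (_ AllPairs.∷ sorted) p | inj₂ q with ∈-map⁻ (setAside x) q
...   | _ , uvR∈ , refl = select₂-ordered sorted uvR∈

map-ends-select₂ : (x : A) (xs : List A) →
                   map ends (select₂ (x ∷ xs)) ≡ map (x ,_) xs ++ map ends (select₂ xs)
map-ends-select₂ x xs = begin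
  map ends (map (pairWith x) (select xs) ++ map (setAside x) (select₂ xs))
    ≡⟨ List.map-++ ends (map (pairWith x) (select xs)) _ ⟩
  map ends (map (pairWith x) (select xs)) ++ map ends (map (setAside x) (select₂ xs))
    ≡⟨ cong₂ _++_ (sym (List.map-∘ (select xs))) (sym (List.map-∘ (select₂ xs))) ⟩
  map ((x ,_) ∘ proj₁) (select xs) ++ map ends (select₂ xs)
    ≡⟨ cong (_++ map ends (select₂ xs)) (trans (List.map-∘ (select xs)) (cong (map (x ,_)) (map-proj₁-select xs))) ⟩
  map (x ,_) xs ++ map ends (select₂ xs) ∎
  where open ≡-Reasoning

Unique-ends-select₂ : {xs : List A} → Unique xs → Unique (map ends (select₂ xs))
Unique-ends-select₂ {xs = []}     _            = []
Unique-ends-select₂ {xs = x ∷ xs} (x∉xs ∷ unq) = subst Unique (sym (map-ends-select₂ x xs))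
  (Unique.++⁺ (Unique.map⁺ (proj₂ ∘ ×-injective) unq) (Unique-ends-select₂ unq) disjoint)
  where
  ×-injective : ∀ {a b c d : A} → (a , b) ≡ (c , d) → a ≡ c × b ≡ d
  ×-injective refl = refl , refl
  disjoint : ∀ {e} → e ∈ map (x ,_) xs × e ∈ map ends (select₂ xs) → ⊥
  disjoint (p , q) with ∈-map⁻ (x ,_) p | ∈-map⁻ ends q
  ... | _ , _ , refl | (u , v , R) , uvR∈ , e with proj₁ (×-injective e)
  ...   | refl = All.lookup x∉xs (↭.∈-resp-↭ (↭-sym (↭-select₂ uvR∈)) (here refl)) refl

length-select₂ : (xs : List A) → length (select₂ xs) ≡ length xs C 2
length-select₂ []       = refl
length-select₂ (x ∷ xs) = begin
  length (map (pairWith x) (select xs) ++ map (setAside x) (select₂ xs))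
    ≡⟨ List.length-++ (map (pairWith x) (select xs)) ⟩
  length (map (pairWith x) (select xs)) + length (map (setAside x) (select₂ xs))
    ≡⟨ cong₂ _+_ (trans (List.length-map (pairWith x) (select xs)) (trans (length-select xs) (sym (nC1≡n (length xs)))))
                 (trans (List.length-map (setAside x) (select₂ xs)) (length-select₂ xs)) ⟩
  length xs C 1 + length xs C 2
    ≡⟨ nCk+nC[k+1]≡[n+1]C[k+1] (length xs) 1 ⟩
  suc (length xs) C 2 ∎
  where open ≡-Reasoning

∈-select₂ : {xs : List (Fin n)} {u v : Fin n} → AllPairs Fin._<_ xs → u ∈ xs → v ∈ xs → u Fin.< v →
            ∃ λ R → (u , v , R) ∈ select₂ xs × (∀ {y} → y ∈ xs → y ≢ u → y ≢ v → y ∈ R)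
∈-select₂ {xs = x ∷ xs} _ (here refl) (here refl) u<v = ⊥-elim (Fin.<-irrefl refl u<v)
∈-select₂ {xs = x ∷ xs} _ (here refl) (there v∈) _ with ∈-select v∈
... | R , vR∈ , rest = R , ∈-++⁺ˡ (∈-map⁺ _ vR∈) ,
                       λ { (here refl) y≢u _ → ⊥-elim (y≢u refl) ; (there y∈) _ y≢v → rest y∈ y≢v }
∈-select₂ {xs = x ∷ xs} (x<xs AllPairs.∷ _) (there u∈) (here refl) u<v = ⊥-elim (Fin.<-asym u<v (All.lookup x<xs u∈))
∈-select₂ {xs = x ∷ xs} (_ AllPairs.∷ sorted) (there u∈) (there v∈) u<v with ∈-select₂ sorted u∈ v∈ u<v
... | R , uvR∈ , rest = x ∷ R , ∈-++⁺ʳ (map _ (select xs)) (∈-map⁺ _ uvR∈) ,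
                        λ { (here refl) _ _ → here refl ; (there y∈) y≢u y≢v → there (rest y∈ y≢u y≢v) }

below : Fin n → List (Fin n)
below M = tabulate (Fin.inject {i = M})

length-below : (M : Fin n) → length (below M) ≡ toℕ M
length-below M = List.length-tabulate Fin.inject

below-sorted : (M : Fin n) → AllPairs Fin._<_ (below M)
below-sorted M = AllPairs.tabulate⁺-< (λ {i} {j} i<j →
  subst₂ ℕ._<_ (sym (Fin.toℕ-inject i)) (sym (Fin.toℕ-inject j)) i<j)

Unique-below : (M : Fin n) → Unique (below M)
Unique-below M = AllPairs.map Fin.<⇒≢ (below-sorted M)

∈-below⁻ : {M y : Fin n} → y ∈ below M → y Fin.< M
∈-below⁻ {M = M} y∈ with ∈-tabulate⁻ y∈
... | j , refl = subst (ℕ._< toℕ M) (sym (Fin.toℕ-inject j)) (Fin.toℕ<n j)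

∈-below⁺ : {M y : Fin n} → y Fin.< M → y ∈ below M
∈-below⁺ {M = M} {y} y<M = subst (_∈ below M) (Fin.toℕ-injective (trans (Fin.toℕ-inject j) (Fin.toℕ-fromℕ< y<M)))
                                 (∈-tabulate⁺ j)
  where
  j = fromℕ< y<M

module _ {n : ℕ} (k′ : ℕ) where

  canonicalWithEnds : Fin n × Fin n × List (Fin n) → List (List (Fin n))
  canonicalWithEnds (u , v , R) = map (λ mid → u ∷ mid ∷ʳ v) (arrangements (suc (k′ + k′)) R)

  canonicalTails : Fin n → List (List (Fin n))
  canonicalTails M = concatMap canonicalWithEnds (select₂ (below M))

  canonicalWithTop : Fin n → List (List (Fin n))
  canonicalWithTop M = map (M ∷_) (canonicalTails M)

canonicalWords : (n k′ : ℕ) → List (List (Fin n))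
canonicalWords n k′ = concatMap (canonicalWithTop k′) (allFin n)

∈-canonicalWords⁻ : ∀ {k′} {w : List (Fin n)} → w ∈ canonicalWords n k′ →
                    Σ (Canonical w) λ c → Canonical.k′ c ≡ k′
∈-canonicalWords⁻ {n} {k′} w∈ with ∈-concatMap⁻′ (canonicalWithTop k′) {allFin n} w∈
... | M , _ , p with ∈-map⁻ (M ∷_) p
... | t , t∈ , refl with ∈-concatMap⁻′ (canonicalWithEnds k′) {select₂ (below M)} t∈
... | (u , v , R) , uvR∈ , q with ∈-map⁻ (λ mid → u ∷ mid ∷ʳ v) q
... | mid , mid∈ , refl with ∈-arrangements⁻ (suc (k′ + k′)) mid∈
... | |mid| , R′ , R↭ =
  mkCanonical M u v mid k′ refl |mid| (M∉ ∷ unq-t) <M (select₂-ordered (below-sorted M) uvR∈) , refl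
  where
  below↭ : below M ↭ u ∷ v ∷ mid ++ R′
  below↭ = ↭-trans (↭-select₂ uvR∈) (↭-prep u (↭-prep v R↭))
  v∷mid↭ : v ∷ mid ↭ mid ∷ʳ v
  v∷mid↭ = ↭.∷↭∷ʳ v mid
  t⊆below : ∀ {y} → y ∈ u ∷ mid ∷ʳ v → y ∈ below M
  t⊆below y∈ = ↭.∈-resp-↭ (↭-sym below↭) (∈-++⁺ˡ (↭.∈-resp-↭ (↭-sym (↭-prep u v∷mid↭)) y∈))
  <M : All (Fin._< M) (u ∷ mid ∷ʳ v)
  <M = All.tabulate (∈-below⁻ ∘ t⊆below)
  M∉ : All (M ≢_) (u ∷ mid ∷ʳ v)
  M∉ = All.map (λ y<M M≡y → Fin.<-irrefl (sym M≡y) y<M) <M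
  unq-t : Unique (u ∷ mid ∷ʳ v)
  unq-t = Unique-resp-↭ (↭-prep u v∷mid↭) (Unique-++⁻ˡ (u ∷ v ∷ mid) (Unique-resp-↭ below↭ (Unique-below M)))

∈-canonicalWords⁺ : {w : List (Fin n)} (c : Canonical w) → w ∈ canonicalWords n (Canonical.k′ c)
∈-canonicalWords⁺ {n} (mkCanonical M u v mid k′ refl |mid| (_ ∷ u∉ ∷ unq-mid∷v) (u<M ∷ <M) u<v)
  with ∈-select₂ (below-sorted M) (∈-below⁺ u<M) (∈-below⁺ (All.lookup <M (∈-++⁺ʳ mid (here refl)))) u<v
... | R , uvR∈ , rest =
  ∈-concatMap⁺′ (canonicalWithTop k′) (∈-allFin M)
    (∈-map⁺ (M ∷_) (∈-concatMap⁺′ (canonicalWithEnds k′) uvR∈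
      (∈-map⁺ (λ mid → u ∷ mid ∷ʳ v)
        (subst (λ r → mid ∈ arrangements r R) |mid| (∈-arrangements⁺ (Unique-++⁻ˡ mid unq-mid∷v) mid⊆R)))))
  where
  mid⊆R : ∀ {y} → y ∈ mid → y ∈ R
  mid⊆R y∈ = rest (∈-below⁺ (All.lookup <M (∈-++⁺ˡ y∈)))
                  (λ y≡u → All.lookup u∉ (∈-++⁺ˡ y∈) (sym y≡u))
                  (λ y≡v → Unique-++⁻-disjoint mid unq-mid∷v y∈ (here y≡v))

Unique-canonicalWords : (n k′ : ℕ) → Unique (canonicalWords n k′)
Unique-canonicalWords n k′ =
  Unique-concatMap⁺ id (subst Unique (sym (List.map-id (allFin n))) (Unique.allFin⁺ n))
    (λ {M} _ → Unique.map⁺ List.∷-injectiveʳ (Unique-canonicalTails M)) ∈-map-∷-head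
  where
  same-ends : ∀ {uvR uvR′ : Fin n × Fin n × List (Fin n)} {w} →
              w ∈ canonicalWithEnds k′ uvR → w ∈ canonicalWithEnds k′ uvR′ → ends uvR ≡ ends uvR′
  same-ends w∈ w∈′ with ∈-map⁻ _ w∈ | ∈-map⁻ _ w∈′
  ... | mid , _ , refl | mid′ , _ , e =
    cong₂ _,_ (List.∷-injectiveˡ e) (List.∷ʳ-injectiveʳ mid mid′ (List.∷-injectiveʳ e))
  Unique-canonicalTails : (M : Fin n) → Unique (canonicalTails k′ M)
  Unique-canonicalTails M = Unique-concatMap⁺ ends (Unique-ends-select₂ (Unique-below M))
    (λ uvR∈ → Unique.map⁺ (List.∷ʳ-injectiveˡ _ _ ∘ List.∷-injectiveʳ)
                (Unique-arrangements (suc (k′ + k′))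
                   (AllPairs.tail (AllPairs.tail (Unique-resp-↭ (↭-select₂ {xs = below M} uvR∈) (Unique-below M))))))
    (λ {uvR} {uvR′} → same-ends {uvR} {uvR′})

map-toℕ-allFin : ∀ n → map toℕ (allFin n) ≡ upTo n
map-toℕ-allFin n = trans (List.map-tabulate id toℕ) (tabulate-toℕ n)
  where
  tabulate-toℕ : ∀ n → tabulate {n = n} toℕ ≡ upTo n
  tabulate-toℕ zero    = refl
  tabulate-toℕ (suc n) = cong (0 ∷_) (begin
    tabulate (suc ∘ toℕ)      ≡⟨ List.map-tabulate toℕ suc ⟨
    map suc (tabulate toℕ)    ≡⟨ cong (map suc) (tabulate-toℕ n) ⟩
    map suc (upTo n)          ≡⟨ List.map-upTo suc n ⟩
    applyUpTo suc n           ∎)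
    where open ≡-Reasoning

length-canonicalWords : (n k′ : ℕ) →
  length (canonicalWords n k′) ≡ sum (map (λ m → (m C 2) * fallingFactorial (m ∸ 2) (suc (k′ + k′))) (upTo n))
length-canonicalWords n k′ = begin
  length (canonicalWords n k′)                            ≡⟨ length-concatMap (canonicalWithTop k′) (allFin n) ⟩
  sum (map (length ∘ canonicalWithTop k′) (allFin n))     ≡⟨ cong sum (List.map-cong length-canonicalWithTop (allFin n)) ⟩
  sum (map (count ∘ toℕ) (allFin n))                      ≡⟨ cong sum (List.map-∘ (allFin n)) ⟩
  sum (map count (map toℕ (allFin n)))                    ≡⟨ cong (sum ∘ map count) (map-toℕ-allFin n) ⟩
  sum (map count (upTo n))                                ∎
  where
  open ≡-Reasoning
  r = suc (k′ + k′)
  count : ℕ → ℕ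
  count m = (m C 2) * fallingFactorial (m ∸ 2) r
  length-canonicalWithTop : (M : Fin n) → length (canonicalWithTop k′ M) ≡ count (toℕ M)
  length-canonicalWithTop M = begin
    length (map (M ∷_) (canonicalTails k′ M))                ≡⟨ List.length-map (M ∷_) (canonicalTails k′ M) ⟩
    length (canonicalTails k′ M)                             ≡⟨ length-concatMap-const (canonicalWithEnds k′) _ |block| ⟩
    length (select₂ (below M)) * fallingFactorial (toℕ M ∸ 2) r
      ≡⟨ cong (_* fallingFactorial (toℕ M ∸ 2) r) (trans (length-select₂ (below M)) (cong (_C 2) (length-below M))) ⟩
    count (toℕ M)                                            ∎
    where
    |block| : ∀ {uvR} → uvR ∈ select₂ (below M) → length (canonicalWithEnds k′ uvR) ≡ fallingFactorial (toℕ M ∸ 2) r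
    |block| {u , v , R} uvR∈ = begin
      length (canonicalWithEnds k′ (u , v , R))   ≡⟨ List.length-map _ (arrangements r R) ⟩
      length (arrangements r R)                   ≡⟨ length-arrangements r R ⟩
      fallingFactorial (length R) r               ≡⟨ cong (λ m → fallingFactorial m r) |R| ⟩
      fallingFactorial (toℕ M ∸ 2) r              ∎
      where
      |R| : length R ≡ toℕ M ∸ 2
      |R| = sym (trans (cong (_∸ 2) (trans (sym (length-below M)) (↭.↭-length (↭-select₂ {xs = below M} uvR∈))))
                       (ℕ.m+n∸m≡n 2 (length R)))

-- Binomial identities

sum-map-*ˡ : (c : ℕ) (f : A → ℕ) (xs : List A) → c * sum (map f xs) ≡ sum (map (λ x → c * f x) xs)
sum-map-*ˡ c f []       = ℕ.*-zeroʳ c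
sum-map-*ˡ c f (x ∷ xs) = trans (ℕ.*-distribˡ-+ c (f x) (sum (map f xs))) (cong (c * f x +_) (sum-map-*ˡ c f xs))

sum-map-*ʳ : (c : ℕ) (f : A → ℕ) (xs : List A) → sum (map (λ x → f x * c) xs) ≡ sum (map f xs) * c
sum-map-*ʳ c f []       = refl
sum-map-*ʳ c f (x ∷ xs) = trans (cong (f x * c +_) (sum-map-*ʳ c f xs)) (sym (ℕ.*-distribʳ-+ c (f x) (sum (map f xs))))

hockey-stick : ∀ m n → sum (map (_C m) (upTo n)) ≡ n C suc m
hockey-stick m zero    = refl
hockey-stick m (suc n) = begin
  sum (map (_C m) (upTo (suc n)))          ≡⟨ cong (sum ∘′ map (_C m)) (List.upTo-∷ʳ n) ⟨
  sum (map (_C m) (upTo n ∷ʳ n))           ≡⟨ cong sum (List.map-++ (_C m) (upTo n) [ n ]) ⟩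
  sum (map (_C m) (upTo n) ++ [ n C m ])   ≡⟨ ℕ.sum-++ (map (_C m) (upTo n)) [ n C m ] ⟩
  sum (map (_C m) (upTo n)) + (n C m + 0)  ≡⟨ cong₂ _+_ (hockey-stick m n) (ℕ.+-identityʳ (n C m)) ⟩
  n C suc m + n C m                        ≡⟨ ℕ.+-comm (n C suc m) (n C m) ⟩
  n C m + n C suc m                        ≡⟨ nCk+nC[k+1]≡[n+1]C[k+1] n m ⟩
  suc n C suc m                            ∎
  where open ≡-Reasoning

absorption : ∀ j m → suc m * (suc j C suc m) ≡ suc j * (j C m)
absorption zero    zero    = refl
absorption zero    (suc m) = ℕ.*-zeroʳ (suc (suc m))
absorption (suc j) zero    = trans (ℕ.*-identityˡ _) (trans (nC1≡n (suc (suc j))) (sym (ℕ.*-identityʳ (suc (suc j)))))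
absorption (suc j) (suc m) = begin
  suc (suc m) * (suc (suc j) C suc (suc m))       ≡⟨ cong (suc (suc m) *_) (nCk+nC[k+1]≡[n+1]C[k+1] (suc j) (suc m)) ⟨
  suc (suc m) * ((suc j C suc m) + Y)             ≡⟨ regroup m (suc j C suc m) Y ⟩
  (suc j C suc m) + suc m * (suc j C suc m) + suc (suc m) * Y
                                                  ≡⟨ cong₂ (λ p q → (suc j C suc m) + p + q) (absorption j m) (absorption j (suc m)) ⟩
  (suc j C suc m) + suc j * a + suc j * b         ≡⟨ cong (λ s → s + suc j * a + suc j * b) (nCk+nC[k+1]≡[n+1]C[k+1] j m) ⟨
  (a + b) + suc j * a + suc j * b                 ≡⟨ collect j a b ⟩
  suc (suc j) * (a + b)                           ≡⟨ cong (suc (suc j) *_) (nCk+nC[k+1]≡[n+1]C[k+1] j m) ⟩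
  suc (suc j) * (suc j C suc m)                   ∎
  where
  open ≡-Reasoning
  a = j C m
  b = j C suc m
  Y = suc j C suc (suc m)
  regroup : ∀ m s y → suc (suc m) * (s + y) ≡ s + suc m * s + suc (suc m) * y
  regroup = solve-∀
  collect : ∀ j a b → (a + b) + suc j * a + suc j * b ≡ suc (suc j) * (a + b)
  collect = solve-∀

fallingFactorial≡C*! : ∀ j m → fallingFactorial j m ≡ (j C m) * m !
fallingFactorial≡C*! j       zero    = refl
fallingFactorial≡C*! zero    (suc m) = refl
fallingFactorial≡C*! (suc j) (suc m) = begin
  suc j * fallingFactorial j m          ≡⟨ cong (suc j *_) (fallingFactorial≡C*! j m) ⟩
  suc j * ((j C m) * m !)               ≡⟨ ℕ.*-assoc (suc j) (j C m) (m !) ⟨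
  (suc j * (j C m)) * m !               ≡⟨ cong (_* m !) (absorption j m) ⟨
  (suc m * (suc j C suc m)) * m !       ≡⟨ swap-factor (suc m) (suc j C suc m) (m !) ⟩
  (suc j C suc m) * (suc m * m !)       ∎
  where
  open ≡-Reasoning
  swap-factor : ∀ x y z → (x * y) * z ≡ y * (x * z)
  swap-factor = solve-∀

2*C2*fallingFactorial : ∀ j r → 2 * ((j C 2) * fallingFactorial (j ∸ 2) r) ≡ fallingFactorial j (suc (suc r))
2*C2*fallingFactorial zero          r = refl
2*C2*fallingFactorial (suc zero)    r = refl
2*C2*fallingFactorial (suc (suc j)) r = begin
  2 * ((suc (suc j) C 2) * fallingFactorial j r)   ≡⟨ ℕ.*-assoc 2 (suc (suc j) C 2) (fallingFactorial j r) ⟨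
  (2 * (suc (suc j) C 2)) * fallingFactorial j r   ≡⟨ cong (_* fallingFactorial j r) (trans (absorption (suc j) 1)
                                                              (cong (suc (suc j) *_) (nC1≡n (suc j)))) ⟩
  (suc (suc j) * suc j) * fallingFactorial j r     ≡⟨ ℕ.*-assoc (suc (suc j)) (suc j) (fallingFactorial j r) ⟩
  suc (suc j) * (suc j * fallingFactorial j r)     ∎
  where open ≡-Reasoning

-- Counting the hyperplanes

CanonicalWord : ℕ → Set
CanonicalWord n = Σ (List (Fin n)) Canonical

canonicity : (n k′ : ℕ) → All Canonical (canonicalWords n k′)
canonicity n k′ = All.tabulate (proj₁ ∘ ∈-canonicalWords⁻ {k′ = k′})

certifiedWords : (n k′ : ℕ) → List (CanonicalWord n)
certifiedWords n k′ = All.toList (canonicity n k′)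

allCanonicalWords : (n : ℕ) → List (CanonicalWord n)
allCanonicalWords n = concatMap (certifiedWords n) (upTo (n / 2 ∸ 1))

∈-allCanonicalWords : {w : List (Fin n)} → Canonical w → ∃ λ c′ → (w , c′) ∈ allCanonicalWords n
∈-allCanonicalWords {n} c =
  Product.map₂ (∈-concatMap⁺′ (certifiedWords n) (∈-upTo⁺ (k′<n/2∸1 c)))
               (∈-toList (canonicity n (Canonical.k′ c)) (∈-canonicalWords⁺ c))

Unique-allCanonicalWords : (n : ℕ) → Unique (map proj₁ (allCanonicalWords n))
Unique-allCanonicalWords n = subst Unique (sym words)
  (Unique-concatMap⁺ id (subst Unique (sym (List.map-id (upTo (n / 2 ∸ 1)))) (Unique.upTo⁺ _))
    (λ {k′} _ → Unique-canonicalWords n k′) same-k′)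
  where
  words : map proj₁ (allCanonicalWords n) ≡ concatMap (canonicalWords n) (upTo (n / 2 ∸ 1))
  words = trans (List.map-concatMap proj₁ (certifiedWords n) (upTo (n / 2 ∸ 1)))
                (List.concatMap-cong (λ k′ → map-proj₁-toList (canonicity n k′)) (upTo (n / 2 ∸ 1)))
  same-k′ : ∀ {k′ k″} {w : List (Fin n)} → w ∈ canonicalWords n k′ → w ∈ canonicalWords n k″ → k′ ≡ k″
  same-k′ w∈ w∈′ with ∈-canonicalWords⁻ w∈ | ∈-canonicalWords⁻ w∈′
  ... | c , refl | c′ , refl = k′-unique c c′

twice-length-canonicalWords : ∀ n k′ →
  2 * length (canonicalWords n k′) ≡ (n C (2 * (2 + k′))) * ((2 * (2 + k′) ∸ 1) !)
twice-length-canonicalWords n k′ = begin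
  2 * length (canonicalWords n k′)                       ≡⟨ cong (2 *_) (length-canonicalWords n k′) ⟩
  2 * sum (map count (upTo n))                           ≡⟨ sum-map-*ˡ 2 count (upTo n) ⟩
  sum (map (λ m → 2 * count m) (upTo n))                 ≡⟨ cong sum (List.map-cong twice-count (upTo n)) ⟩
  sum (map (λ m → (m C (2 + r)) * (2 + r) !) (upTo n))   ≡⟨ sum-map-*ʳ ((2 + r) !) (_C (2 + r)) (upTo n) ⟩
  sum (map (_C (2 + r)) (upTo n)) * (2 + r) !            ≡⟨ cong (_* (2 + r) !) (hockey-stick (2 + r) n) ⟩
  (n C (3 + r)) * (2 + r) !                              ≡⟨ cong (λ K → (n C K) * ((K ∸ 1) !)) (2K≡3+r k′) ⟨
  (n C (2 * (2 + k′))) * ((2 * (2 + k′) ∸ 1) !)          ∎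
  where
  open ≡-Reasoning
  r = suc (k′ + k′)
  count : ℕ → ℕ
  count m = (m C 2) * fallingFactorial (m ∸ 2) r
  twice-count : ∀ m → 2 * count m ≡ (m C (2 + r)) * (2 + r) !
  twice-count m = trans (2*C2*fallingFactorial m r) (fallingFactorial≡C*! m (2 + r))
  2K≡3+r : ∀ k′ → 2 * (2 + k′) ≡ 3 + suc (k′ + k′)
  2K≡3+r = solve-∀

twice-length-allCanonicalWords : (n : ℕ) → 2 * length (allCanonicalWords n) ≡ twiceCount n
twice-length-allCanonicalWords n = begin
  2 * length (concatMap (certifiedWords n) ks)                ≡⟨ cong (2 *_) (length-concatMap (certifiedWords n) ks) ⟩
  2 * sum (map (length ∘ certifiedWords n) ks)                ≡⟨ sum-map-*ˡ 2 (length ∘ certifiedWords n) ks ⟩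
  sum (map (λ k′ → 2 * length (certifiedWords n k′)) ks)      ≡⟨ cong sum (List.map-cong term ks) ⟩
  sum (map (binomialTerm ∘ (2 +_)) ks)                        ≡⟨ cong sum (List.map-∘ ks) ⟩
  twiceCount n                                                ∎
  where
  open ≡-Reasoning
  ks = upTo (n / 2 ∸ 1)
  binomialTerm : ℕ → ℕ
  binomialTerm k = (n C (2 * k)) * ((2 * k ∸ 1) !)
  term : ∀ k′ → 2 * length (certifiedWords n k′) ≡ binomialTerm (2 + k′)
  term k′ = trans (cong (2 *_) (length-toList (canonicity n k′))) (twice-length-canonicalWords n k′)

hyperplanes : (n : ℕ) → List (WData n)
hyperplanes n = map (toWData ∘ proj₂) (allCanonicalWords n)

hyperplanes-distinct : ∀ (i j : Fin (length (hyperplanes n))) → i ≢ j →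
                       ¬ SameHyp (lookup (hyperplanes n) i) (lookup (hyperplanes n) j)
hyperplanes-distinct {n} = AllPairs-lookup {R = λ D E → ¬ SameHyp D E}
  (λ {D} {E} ¬same same → ¬same (SameHyp-sym {D = E} {E = D} same))
  (AllPairs.map⁺ (AllPairs.map (λ {x} {y} w≢w′ same → w≢w′ (SameHyp-toWData⇒≡ (proj₂ x) (proj₂ y) same))
                               (AllPairs.map⁻ (Unique-allCanonicalWords n))))

hyperplanes-complete : (D : WData n) → Σ (Fin (length (hyperplanes n))) λ i → SameHyp D (lookup (hyperplanes n) i)
hyperplanes-complete {n} D with canonical-form D
... | w , c , H⇔ with ∈-allCanonicalWords c
... | c′ , w∈ = Any.index found , Any.lookup-index found
  where
  same : SameHyp D (toWData c′)
  same x = Equivalence.to H⇔H′ , Equivalence.from H⇔H′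
    where
    H⇔H′ = ⇔.trans (H⇔ x) (≡⇒⇔ (sym (H-toWData c′ x)))
  found : Any (SameHyp D) (hyperplanes n)
  found = Any.map⁺ (Any.map (λ { refl → same }) w∈)

twice-length-hyperplanes : (n : ℕ) → 2 * length (hyperplanes n) ≡ twiceCount n
twice-length-hyperplanes n =
  trans (cong (2 *_) (List.length-map _ (allCanonicalWords n))) (twice-length-allCanonicalWords n)

proposition3p7 : (n : ℕ) → 1 ≤ n →
    Σ (List (WData n)) λ L →
      (∀ (i j : Fin (length L)) → i ≢ j → ¬ SameHyp (lookup L i) (lookup L j))
      × (∀ (D : WData n) → Σ (Fin (length L)) λ i → SameHyp D (lookup L i))
      × (2 * length L ≡ twiceCount n)
proposition3p7 n _ = hyperplanes n , hyperplanes-distinct , hyperplanes-complete , twice-length-hyperplanes n
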